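{- Let $q=2^k t+1$ be a prime power, where $k>1$ is an integer and $t>1$ is an odd integer. Let $\alpha$ be a generator of the cyclic group $QR(q)$, let $C_0=\langle\alpha^{2^{k-1}}\rangle$ (the subgroup of order $t$), and for $j=0,\dots,2^{k-2}-1$ let $C_j=\alpha^jC_0$ and $\hat C_j=-C_j$. For $\gamma_1,\gamma_2\in\mathbb{F}_q^*$ define $$S(\gamma_1,\gamma_2)=\bigcup_{j=0}^{2^{k-2}-1}\big\{\{x,\gamma_1x\},\{y,-\gamma_2y\}: x\in C_j,\ y\in\hat C_j\big\}.$$ Suppose $\beta_1\in NQR(q)$ and $\beta_2\in\beta_1\hat C_0$ satisfy $(\beta_1-1)(\beta_2+1)\in NQR(q)$ and $(\beta_1+1)(\beta_2-1)\in NQR(q)$, so that $S(\beta_1,\beta_2)$ is a two-quotient strong starter for $\mathbb{F}_q$. Then $S(\beta_2,\beta_1)$, $S(-\beta_1,-\beta_2)$ and $S(-\beta_2,-\beta_1)$ are two-quotient strong starters for $\mathbb{F}_q$, each different from $S(\beta_1,\beta_2)$.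
   Context: For a finite additive abelian group $G$ of odd order $n$ with $G^*=G\setminus\{0\}$, a starter for $G$ is a set $S=\{\{x_i,y_i\}: i=1,\dots,\frac{n-1}{2}\}$ of unordered pairs with $\bigcup_i\{x_i,y_i\}=G^*$ and $\{\pm(x_i-y_i)\}=G^*$; it is strong if the sums $x_i+y_i$ are pairwise distinct. A starter (for $G=\mathbb{F}_q$) is a $k$-quotient starter if there is $Q\subseteq\mathbb{F}_q^*$ with $|Q|=k$ such that for each pair, $y_i/x_i\in Q$ or $x_i/y_i\in Q$; two-quotient means $k=2$. $QR(q)$ is the set of nonzero squares of $\mathbb{F}_q^*$, $NQR(q)$ the set of non-squares. -}

module Defs where

open import Level using (0ℓ)
open import Data.Nat as ℕ using (ℕ; _^_; _<_; _≤_)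
open import Data.Nat.Primality using (Prime)
open import Data.Fin using (Fin)
open import Data.Product using (Σ; ∃; ∃-syntax; _×_; _,_)
open import Data.Sum using (_⊎_)
open import Relation.Nullary using (¬_; Dec)
open import Relation.Binary.PropositionalEquality using (_≡_; _≢_)
open import Algebra.Structures using (IsCommutativeRing)
open import Function.Bundles using (_↔_)

IsPrimePower : ℕ → Set
IsPrimePower q = ∃[ p ] ∃[ e ] (Prime p × 1 ≤ e × q ≡ p ^ e)

-- Any field of order q is isomorphic to one of this form, so quantifying over
-- all such records is quantifying over (models of) 𝔽_q.
record FiniteField (q : ℕ) : Set₁ where
  infixl 6 _+_ _-_
  infixl 7 _*_
  infix  8 -_
  infix  9 _⁻¹
  field
    Carrier : Set
    _+_ _*_ : Carrier → Carrier → Carrier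
    -_      : Carrier → Carrier
    0# 1#   : Carrier
    isCommutativeRing : IsCommutativeRing _≡_ _+_ _*_ -_ 0# 1#
    0≢1     : 0# ≢ 1#
    _⁻¹     : Carrier → Carrier
    ⁻¹-inverse : ∀ x → x ≢ 0# → x * x ⁻¹ ≡ 1#
    _≟_     : (x y : Carrier) → Dec (x ≡ y)
    enumeration : Fin q ↔ Carrier

  _-_ : Carrier → Carrier → Carrier
  x - y = x + (- y)

  _/_ : Carrier → Carrier → Carrier
  y / x = y * x ⁻¹

  _^'_ : Carrier → ℕ → Carrier
  x ^' ℕ.zero  = 1#
  x ^' ℕ.suc n = x * (x ^' n)

  QR : Carrier → Set
  QR x = x ≢ 0# × ∃[ y ] (y * y ≡ x)

  NQR : Carrier → Set
  NQR x = x ≢ 0# × ¬ QR x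

  GeneratesQR : Carrier → Set
  GeneratesQR α = QR α × (∀ x → QR x → ∃[ m ] (α ^' m ≡ x))

  -- Sets of unordered pairs are represented as symmetric predicates
  -- P x y  ("{x,y} ∈ S").
  PairSet : Set₁
  PairSet = Carrier → Carrier → Set

  record IsStarter (S : PairSet) : Set where
    field
      symmetric  : ∀ {x y} → S x y → S y x
      nonzero    : ∀ {x y} → S x y → x ≢ 0#
      distinct   : ∀ {x y} → S x y → x ≢ y
      covers     : ∀ x → x ≢ 0# → ∃[ y ] S x y
      unique     : ∀ {x y z} → S x y → S x z → y ≡ z
      differences : ∀ d → d ≢ 0# → ∃[ x ] ∃[ y ] (S x y × x - y ≡ d)

  IsStrong : PairSet → Set
  IsStrong S = ∀ {x y u v} → S x y → S u v → x + y ≡ u + v →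
               (u ≡ x × v ≡ y) ⊎ (u ≡ y × v ≡ x)

  IsTwoQuotient : PairSet → Set
  IsTwoQuotient S = ∃[ a ] ∃[ b ] (a ≢ 0# × b ≢ 0# × a ≢ b ×
    (∀ {x y} → S x y → (y / x ≡ a ⊎ y / x ≡ b) ⊎ (x / y ≡ a ⊎ x / y ≡ b)))

  IsTwoQuotientStrongStarter : PairSet → Set
  IsTwoQuotientStrongStarter S = IsStarter S × IsStrong S × IsTwoQuotient S

  SamePairSet : PairSet → PairSet → Set
  SamePairSet S T = ∀ x y → (S x y → T x y) × (T x y → S x y)

  module Construction (k : ℕ) (α : Carrier) where
    C₀ : Carrier → Set
    C₀ x = ∃[ m ] (x ≡ (α ^' (2 ^ (k ℕ.∸ 1))) ^' m)

    C : ℕ → Carrier → Set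
    C j x = ∃[ c ] (C₀ c × x ≡ (α ^' j) * c)

    Ĉ : ℕ → Carrier → Set
    Ĉ j x = ∃[ c ] (C j c × x ≡ - c)

    S : Carrier → Carrier → PairSet
    S γ₁ γ₂ u v = ∃[ j ] (j < 2 ^ (k ℕ.∸ 2) ×
       ( (∃[ x ] (C j x × ((u ≡ x × v ≡ γ₁ * x) ⊎ (u ≡ γ₁ * x × v ≡ x))))
       ⊎ (∃[ y ] (Ĉ j y × ((u ≡ y × v ≡ - (γ₂ * y)) ⊎ (u ≡ - (γ₂ * y) × v ≡ y))))))

-- Every pair of
-- S(γ₁, γ₂) consists of a square p ∈ ⋃ C_j ∪ ⋃ Ĉ_j and a non-square γ₁p or -γ₂p = γ₁(-c)p, and
-- the squares split as QR = ⋃ C_j ⊎ ⋃ Ĉ_j because -1 = α^(ht) shifts exponents by h modulo 2h.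
-- Hence S(γ₁, γ₂) partitions F*; the sums (1 + γ₁)p and (1 - γ₂)p′ of pairs of the two kinds
-- lie in different square classes by the second condition, which gives strength; and every
-- d ≠ 0 is (1 - γ₁)w or (1 + γ₂)w with w a square by the first one, which gives the differences.
-- The three companions of (β₁, β₂) satisfy the same hypotheses, since Ĉ₀ is closed under
-- inverses and negating both parameters swaps the two conditions.  They differ from
-- S(β₁, β₂) because the partner of 1 in S(γ₁, γ₂) is γ₁, and γ₁ ≠ β₁ in all three cases.

module Submission where

open import Defs
open import Data.Nat as ℕ using (ℕ)
open import Data.Nat.DivMod using (_%_)
open import Data.Product using (∃-syntax; _×_)
open import Relation.Nullary using (¬_)
open import Relation.Binary.PropositionalEquality using (_≡_)

open import Algebra.Bundles using (CommutativeRing)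
open import Algebra.Solver.Ring.AlmostCommutativeRing
  using (fromCommutativeRing; _-Raw-AlmostCommutative⟶_; Induced-equivalence)
import Data.Integer.Properties as ℤ
open import Data.Empty using (⊥; ⊥-elim)
open import Data.Fin.Base using (Fin)
import Data.Fin.Base as Fin
import Data.Fin.Properties as Fin
open import Data.Maybe.Base using (just; nothing)
open import Data.Nat.Base as ℕ using (zero; suc)
import Data.Nat.Properties as ℕ
open import Data.Nat.DivMod using (m≡m%n+[m/n]*n; m%n<n; [m+kn]%n≡m%n; m<n⇒m%n≡m; m∣n⇒o%n%m≡o%m)
open import Data.Nat.Divisibility using (_∣_; divides)
open import Data.Nat.Tactic.RingSolver using (solve-∀)
open import Data.Product using (∃; _,_; proj₁; proj₂)
open import Data.Sign.Base as Sign using (Sign)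
open import Data.Sum as Sum using (_⊎_; inj₁; inj₂; [_,_]′)
open import Data.Vec.Functional using (_∷_)
open import Function.Base using (_∘_)
open import Function.Bundles using (Inverse)
open import Function.Definitions using (Injective)
open import Level using (0ℓ)
open import Relation.Binary.Definitions using (WeaklyDecidable; tri<; tri≈; tri>)
import Relation.Binary.PropositionalEquality as ≡
open ≡ using (_≢_)
open import Relation.Nullary.Decidable using (Dec; yes; no)

-- Ring solver for an abstract commutative ring R with ℤ as coefficient ring: over R itself the
-- solver could not see that e.g. 1# - 1# is 0#, whereas integer coefficients normalise by
-- computation.  The optimised multiple n · 1# makes ⟦ + 1 ⟧ℤ reduce to 1#, so :1 is 1# on the nose.
module IntegerCoefficients {c ℓ} (R : CommutativeRing c ℓ) where
  open import Data.Integer.Base as ℤ using (ℤ; +_; -[1+_]; _⊖_; _◃_; sign; ∣_∣)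
  open CommutativeRing R
  open import Algebra.Properties.Ring ring using (-‿distribˡ-*; -‿distribʳ-*; -‿involutive; -0#≈0#)
  open import Algebra.Properties.AbelianGroup +-abelianGroup using (⁻¹-∙-comm)
  open import Algebra.Properties.CommutativeSemigroup +-commutativeSemigroup using (interchange)
  open import Algebra.Properties.Semiring.Mult.TCOptimised semiring using (×-homo-+; ×1-homo-*; 1+×)
    renaming (_×_ to _·_)
  open import Relation.Binary.Reasoning.Setoid setoid

  ⟦_⟧ℤ : ℤ → Carrier
  ⟦ + n ⟧ℤ     = n · 1#
  ⟦ -[1+ n ] ⟧ℤ = - (suc n · 1#)

  signed : Sign → Carrier → Carrier
  signed Sign.+ x = x
  signed Sign.- x = - x

  signed-cong : ∀ s {x y} → x ≈ y → signed s x ≈ signed s y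
  signed-cong Sign.+ x≈y = x≈y
  signed-cong Sign.- x≈y = -‿cong x≈y

  signed-* : ∀ s t x y → signed (s Sign.* t) (x * y) ≈ signed s x * signed t y
  signed-* Sign.+ Sign.+ x y = refl
  signed-* Sign.+ Sign.- x y = -‿distribʳ-* x y
  signed-* Sign.- Sign.+ x y = -‿distribˡ-* x y
  signed-* Sign.- Sign.- x y = begin
    x * y         ≈⟨ -‿involutive (x * y) ⟨
    - - (x * y)   ≈⟨ -‿cong (-‿distribˡ-* x y) ⟩
    - (- x * y)   ≈⟨ -‿distribʳ-* (- x) y ⟩
    - x * - y     ∎

  ⟦◃⟧ : ∀ s n → ⟦ s ◃ n ⟧ℤ ≈ signed s (n · 1#)
  ⟦◃⟧ Sign.+ zero    = refl
  ⟦◃⟧ Sign.- zero    = sym -0#≈0#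
  ⟦◃⟧ Sign.+ (suc n) = refl
  ⟦◃⟧ Sign.- (suc n) = refl

  ⟦⟧≈signed : ∀ i → ⟦ i ⟧ℤ ≈ signed (sign i) (∣ i ∣ · 1#)
  ⟦⟧≈signed i = begin
    ⟦ i ⟧ℤ                        ≡⟨ ≡.cong ⟦_⟧ℤ (ℤ.◃-inverse i) ⟨
    ⟦ sign i ◃ ∣ i ∣ ⟧ℤ           ≈⟨ ⟦◃⟧ (sign i) ∣ i ∣ ⟩
    signed (sign i) (∣ i ∣ · 1#)  ∎

  [a+x]-[a+y]≈x-y : ∀ a x y → (a + x) - (a + y) ≈ x - y
  [a+x]-[a+y]≈x-y a x y = begin
    (a + x) - (a + y)      ≈⟨ +-congˡ (⁻¹-∙-comm a y) ⟨
    (a + x) + (- a - y)    ≈⟨ interchange a x (- a) (- y) ⟩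
    (a - a) + (x - y)      ≈⟨ +-congʳ (-‿inverseʳ a) ⟩
    0# + (x - y)           ≈⟨ +-identityˡ (x - y) ⟩
    x - y                  ∎

  ⟦⊖⟧ : ∀ m n → ⟦ m ⊖ n ⟧ℤ ≈ m · 1# - n · 1#
  ⟦⊖⟧ m       zero    = begin
    m · 1#        ≈⟨ +-identityʳ _ ⟨
    m · 1# + 0#   ≈⟨ +-congˡ -0#≈0# ⟨
    m · 1# - 0#   ∎
  ⟦⊖⟧ zero    (suc n) = sym (+-identityˡ _)
  ⟦⊖⟧ (suc m) (suc n) = begin
    ⟦ suc m ⊖ suc n ⟧ℤ               ≡⟨ ≡.cong ⟦_⟧ℤ (ℤ.[1+m]⊖[1+n]≡m⊖n m n) ⟩
    ⟦ m ⊖ n ⟧ℤ                       ≈⟨ ⟦⊖⟧ m n ⟩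
    m · 1# - n · 1#                  ≈⟨ [a+x]-[a+y]≈x-y 1# (m · 1#) (n · 1#) ⟨
    (1# + m · 1#) - (1# + n · 1#)    ≈⟨ +-cong (1+× m 1#) (-‿cong (1+× n 1#)) ⟨
    suc m · 1# - suc n · 1#          ∎

  ⟦⟧-homo-+ : ∀ i j → ⟦ i ℤ.+ j ⟧ℤ ≈ ⟦ i ⟧ℤ + ⟦ j ⟧ℤ
  ⟦⟧-homo-+ (+ m)    (+ n)    = ×-homo-+ 1# m n
  ⟦⟧-homo-+ (+ m)    -[1+ n ] = ⟦⊖⟧ m (suc n)
  ⟦⟧-homo-+ -[1+ m ] (+ n)    = trans (⟦⊖⟧ n (suc m)) (+-comm _ _)
  ⟦⟧-homo-+ -[1+ m ] -[1+ n ] = begin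
    - (suc (suc (m ℕ.+ n)) · 1#)        ≡⟨ ≡.cong (λ k → - (suc k · 1#)) (ℕ.+-suc m n) ⟨
    - ((suc m ℕ.+ suc n) · 1#)          ≈⟨ -‿cong (×-homo-+ 1# (suc m) (suc n)) ⟩
    - (suc m · 1# + suc n · 1#)         ≈⟨ ⁻¹-∙-comm _ _ ⟨
    - (suc m · 1#) - (suc n · 1#)       ∎

  ⟦⟧-homo-* : ∀ i j → ⟦ i ℤ.* j ⟧ℤ ≈ ⟦ i ⟧ℤ * ⟦ j ⟧ℤ
  ⟦⟧-homo-* i j = begin
    ⟦ s ◃ ∣ i ∣ ℕ.* ∣ j ∣ ⟧ℤ                                    ≈⟨ ⟦◃⟧ s (∣ i ∣ ℕ.* ∣ j ∣) ⟩
    signed s ((∣ i ∣ ℕ.* ∣ j ∣) · 1#)                           ≈⟨ signed-cong s (×1-homo-* ∣ i ∣ ∣ j ∣) ⟩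
    signed s ((∣ i ∣ · 1#) * (∣ j ∣ · 1#))                      ≈⟨ signed-* (sign i) (sign j) _ _ ⟩
    signed (sign i) (∣ i ∣ · 1#) * signed (sign j) (∣ j ∣ · 1#) ≈⟨ *-cong (⟦⟧≈signed i) (⟦⟧≈signed j) ⟨
    ⟦ i ⟧ℤ * ⟦ j ⟧ℤ                                             ∎
    where
    s : Sign
    s = sign i Sign.* sign j

  ⟦⟧-homo-neg : ∀ i → ⟦ ℤ.- i ⟧ℤ ≈ - ⟦ i ⟧ℤ
  ⟦⟧-homo-neg (+ zero)  = sym -0#≈0#
  ⟦⟧-homo-neg (+ suc n) = refl
  ⟦⟧-homo-neg -[1+ n ]  = sym (-‿involutive _)

  morphism : ℤ.+-*-rawRing -Raw-AlmostCommutative⟶ fromCommutativeRing R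
  morphism = record
    { ⟦_⟧    = ⟦_⟧ℤ
    ; +-homo = ⟦⟧-homo-+
    ; *-homo = ⟦⟧-homo-*
    ; -‿homo = ⟦⟧-homo-neg
    ; 0-homo = refl
    ; 1-homo = refl
    }

  ⟦⟧-≟ : WeaklyDecidable (Induced-equivalence morphism)
  ⟦⟧-≟ i j with i ℤ.≟ j
  ... | yes ≡.refl = just refl
  ... | no _       = nothing

  open import Algebra.Solver.Ring ℤ.+-*-rawRing (fromCommutativeRing R) morphism ⟦⟧-≟ public
    using (Polynomial; solve; _:=_; con; _:+_; _:*_; _:-_; :-_)

  :1 : ∀ {n} → Polynomial n
  :1 = con (+ 1)

module FieldProperties {q : ℕ} (F : FiniteField q) where
  open FiniteField F
  open Inverse enumeration using (to; from; inverseˡ; inverseʳ)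
  open ≡ using (_≡_; _≢_; refl; sym; trans; cong; cong₂; subst; module ≡-Reasoning)

  commutativeRing : CommutativeRing 0ℓ 0ℓ
  commutativeRing = record { isCommutativeRing = isCommutativeRing }

  open CommutativeRing commutativeRing public
    using (+-assoc; +-comm; +-identityˡ; +-identityʳ; *-assoc; *-comm; *-identityˡ; *-identityʳ;
           -‿inverseʳ; zeroˡ; zeroʳ)
  open import Algebra.Properties.Ring (CommutativeRing.ring commutativeRing) public
    using (-‿involutive; -0#≈0#; -‿distribˡ-*; -1*x≈-x)
  open IntegerCoefficients commutativeRing public using (solve; _:=_; _:+_; _:*_; _:-_; :-_; :1)
  open ≡-Reasoning

  -x*-y≡x*y : ∀ x y → - x * - y ≡ x * y
  -x*-y≡x*y x y = solve 2 (λ x y → :- x :* :- y := x :* y) refl x y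

  [xy]²≡x²y² : ∀ x y → (x * y) * (x * y) ≡ (x * x) * (y * y)
  [xy]²≡x²y² x y = solve 2 (λ x y → (x :* y) :* (x :* y) := (x :* x) :* (y :* y)) refl x y

  x⁻¹*x≡1 : ∀ {x} → x ≢ 0# → x ⁻¹ * x ≡ 1#
  x⁻¹*x≡1 {x} x≢0 = trans (*-comm (x ⁻¹) x) (⁻¹-inverse x x≢0)

  *-cancelˡ : ∀ {a x y} → a ≢ 0# → a * x ≡ a * y → x ≡ y
  *-cancelˡ {a} {x} {y} a≢0 ax≡ay = begin
    x                ≡⟨ *-identityˡ x ⟨
    1# * x           ≡⟨ cong (_* x) (x⁻¹*x≡1 a≢0) ⟨
    (a ⁻¹ * a) * x   ≡⟨ *-assoc (a ⁻¹) a x ⟩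
    a ⁻¹ * (a * x)   ≡⟨ cong (a ⁻¹ *_) ax≡ay ⟩
    a ⁻¹ * (a * y)   ≡⟨ *-assoc (a ⁻¹) a y ⟨
    (a ⁻¹ * a) * y   ≡⟨ cong (_* y) (x⁻¹*x≡1 a≢0) ⟩
    1# * y           ≡⟨ *-identityˡ y ⟩
    y                ∎

  *-nonzero : ∀ {x y} → x ≢ 0# → y ≢ 0# → x * y ≢ 0#
  *-nonzero {x} x≢0 y≢0 xy≡0 = y≢0 (*-cancelˡ x≢0 (trans xy≡0 (sym (zeroʳ x))))

  *-nonzeroˡ : ∀ {x y} → x * y ≢ 0# → x ≢ 0#
  *-nonzeroˡ {y = y} xy≢0 x≡0 = xy≢0 (trans (cong (_* y) x≡0) (zeroˡ y))

  *-nonzeroʳ : ∀ {x y} → x * y ≢ 0# → y ≢ 0#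
  *-nonzeroʳ {x} xy≢0 y≡0 = xy≢0 (trans (cong (x *_) y≡0) (zeroʳ x))

  ⁻¹-nonzero : ∀ {x} → x ≢ 0# → x ⁻¹ ≢ 0#
  ⁻¹-nonzero {x} x≢0 x⁻¹≡0 =
    0≢1 (trans (sym (zeroʳ x)) (trans (cong (x *_) (sym x⁻¹≡0)) (⁻¹-inverse x x≢0)))

  -‿injective : ∀ {x y} → - x ≡ - y → x ≡ y
  -‿injective {x} {y} -x≡-y = trans (sym (-‿involutive x)) (trans (cong -_ -x≡-y) (-‿involutive y))

  -‿nonzero : ∀ {x} → x ≢ 0# → - x ≢ 0#
  -‿nonzero x≢0 -x≡0 = x≢0 (-‿injective (trans -x≡0 (sym -0#≈0#)))

  [y*x]/x≡y : ∀ {x} y → x ≢ 0# → (y * x) / x ≡ y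
  [y*x]/x≡y {x} y x≢0 = begin
    (y * x) * x ⁻¹   ≡⟨ *-assoc y x (x ⁻¹) ⟩
    y * (x * x ⁻¹)   ≡⟨ cong (y *_) (⁻¹-inverse x x≢0) ⟩
    y * 1#           ≡⟨ *-identityʳ y ⟩
    y                ∎

  x*[y/x]≡y : ∀ {x} y → x ≢ 0# → x * (y / x) ≡ y
  x*[y/x]≡y {x} y x≢0 = begin
    x * (y * x ⁻¹)   ≡⟨ solve 3 (λ x y v → x :* (y :* v) := y :* (x :* v)) refl x y (x ⁻¹) ⟩
    y * (x * x ⁻¹)   ≡⟨ cong (y *_) (⁻¹-inverse x x≢0) ⟩
    y * 1#           ≡⟨ *-identityʳ y ⟩
    y                ∎

  x-y≡0⇒x≡y : ∀ {x y} → x - y ≡ 0# → x ≡ y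
  x-y≡0⇒x≡y {x} {y} x-y≡0 = begin
    x             ≡⟨ solve 2 (λ x y → x := (x :- y) :+ y) refl x y ⟩
    (x - y) + y   ≡⟨ cong (_+ y) x-y≡0 ⟩
    0# + y        ≡⟨ +-identityˡ y ⟩
    y             ∎

  x²≡y²⇒x≡±y : ∀ {x y} → x * x ≡ y * y → x ≡ y ⊎ x ≡ - y
  x²≡y²⇒x≡±y {x} {y} x²≡y² with (x - y) ≟ 0# | (x + y) ≟ 0#
  ... | yes x-y≡0 | _         = inj₁ (x-y≡0⇒x≡y x-y≡0)
  ... | no _      | yes x+y≡0 =
    inj₂ (x-y≡0⇒x≡y (trans (cong (x +_) (-‿involutive y)) x+y≡0))
  ... | no x-y≢0  | no x+y≢0  = ⊥-elim (*-nonzero x-y≢0 x+y≢0 (begin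
    (x - y) * (x + y)   ≡⟨ solve 2 (λ x y → (x :- y) :* (x :+ y) := x :* x :- y :* y) refl x y ⟩
    x * x - y * y       ≡⟨ cong (_- y * y) x²≡y² ⟩
    y * y - y * y       ≡⟨ -‿inverseʳ (y * y) ⟩
    0#                  ∎))

  QR-* : ∀ {x y} → QR x → QR y → QR (x * y)
  QR-* {x} {y} (x≢0 , a , a²≡x) (y≢0 , b , b²≡y) = *-nonzero x≢0 y≢0 , a * b , (begin
    (a * b) * (a * b)   ≡⟨ [xy]²≡x²y² a b ⟩
    (a * a) * (b * b)   ≡⟨ cong₂ _*_ a²≡x b²≡y ⟩
    x * y               ∎)

  QR-square : ∀ {x} → x ≢ 0# → QR (x * x)
  QR-square x≢0 = *-nonzero x≢0 x≢0 , _ , refl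

  1∈QR : QR 1#
  1∈QR = (λ 1≡0 → 0≢1 (sym 1≡0)) , 1# , *-identityˡ 1#

  QR*NQR⇒NQR : ∀ {s x} → QR s → NQR x → NQR (s * x)
  QR*NQR⇒NQR {s} {x} (s≢0 , w , w²≡s) (x≢0 , x∉QR) =
    *-nonzero s≢0 x≢0 , λ { (_ , y , y²≡sx) → x∉QR (x≢0 , y * w ⁻¹ , root y y²≡sx) }
    where
    w≢0 : w ≢ 0#
    w≢0 = *-nonzeroˡ (subst (_≢ 0#) (sym w²≡s) s≢0)
    v : Carrier
    v = w ⁻¹
    root : ∀ y → y * y ≡ s * x → (y * v) * (y * v) ≡ x
    root y y²≡sx = begin
      (y * v) * (y * v)          ≡⟨ [xy]²≡x²y² y v ⟩
      (y * y) * (v * v)          ≡⟨ cong (_* (v * v)) (trans y²≡sx (cong (_* x) (sym w²≡s))) ⟩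
      ((w * w) * x) * (v * v)    ≡⟨ solve 3 (λ w x v → (w :* w :* x) :* (v :* v) := (w :* v) :* (w :* v) :* x)
                                      refl w x v ⟩
      ((w * v) * (w * v)) * x    ≡⟨ cong (λ z → (z * z) * x) (⁻¹-inverse w w≢0) ⟩
      (1# * 1#) * x              ≡⟨ solve 1 (λ x → (:1 :* :1) :* x := x) refl x ⟩
      x                          ∎

  QR≢NQR : ∀ {a b} → QR a → NQR b → a ≢ b
  QR≢NQR a∈QR (_ , b∉QR) refl = b∉QR a∈QR

  ∃? : (P : Carrier → Set) → (∀ x → Dec (P x)) → Dec (∃ P)
  ∃? P P? with Fin.any? (λ i → P? (to i))
  ... | yes (i , p) = yes (to i , p)
  ... | no ¬p       = no λ { (x , p) → ¬p (from x , subst P (sym (inverseˡ refl)) p) }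

  QR? : ∀ x → Dec (QR x)
  QR? x with x ≟ 0# | ∃? (λ y → y * y ≡ x) (λ y → (y * y) ≟ x)
  ... | yes x≡0 | _       = no λ x∈QR → proj₁ x∈QR x≡0
  ... | no x≢0  | yes √x  = yes (x≢0 , √x)
  ... | no _    | no ¬√x  = no λ x∈QR → ¬√x (proj₂ x∈QR)

  from-injective : ∀ {x y} → from x ≡ from y → x ≡ y
  from-injective {x} {y} eq = trans (sym (inverseˡ refl)) (trans (cong to eq) (inverseˡ refl))

  to-injective : ∀ {i j} → to i ≡ to j → i ≡ j
  to-injective {i} {j} eq = trans (sym (inverseʳ refl)) (trans (cong from eq) (inverseʳ refl))

  injection⇒≤ : ∀ {n} (f : Fin n → Carrier) → Injective _≡_ _≡_ f → n ℕ.≤ q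
  injection⇒≤ f f-inj = Fin.injective⇒≤ (λ eq → f-inj (from-injective eq))

  ∷-injective : ∀ {n x} (f : Fin n → Carrier) → Injective _≡_ _≡_ f → (∀ i → f i ≢ x) →
                Injective _≡_ _≡_ (x ∷ f)
  ∷-injective f f-inj f≢x {Fin.zero}  {Fin.zero}  _  = refl
  ∷-injective f f-inj f≢x {Fin.zero}  {Fin.suc j} eq = ⊥-elim (f≢x j (sym eq))
  ∷-injective f f-inj f≢x {Fin.suc i} {Fin.zero}  eq = ⊥-elim (f≢x i eq)
  ∷-injective f f-inj f≢x {Fin.suc i} {Fin.suc j} eq = cong Fin.suc (f-inj eq)

  nonzeroInjection⇒< : ∀ {n} (f : Fin n → Carrier) → Injective _≡_ _≡_ f → (∀ i → f i ≢ 0#) →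
                       n ℕ.< q
  nonzeroInjection⇒< f f-inj f≢0 = injection⇒≤ (0# ∷ f) (∷-injective f f-inj f≢0)

  nonzeroInjection-surjective : ∀ {n} (f : Fin n → Carrier) → Injective _≡_ _≡_ f →
                                (∀ i → f i ≢ 0#) → q ≡ suc n → ∀ x → x ≢ 0# → ∃ λ i → f i ≡ x
  nonzeroInjection-surjective {n} f f-inj f≢0 q≡1+n x x≢0 with Fin.any? (λ i → f i ≟ x)
  ... | yes hit = hit
  ... | no miss = ⊥-elim (ℕ.<-irrefl (sym q≡1+n) (injection⇒≤ (0# ∷ (x ∷ f)) x∷f-inj))
    where
    x∷f-inj : Injective _≡_ _≡_ (0# ∷ (x ∷ f))
    x∷f-inj = ∷-injective (x ∷ f) (∷-injective f f-inj (λ i fi≡x → miss (i , fi≡x)))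
      λ { Fin.zero → x≢0 ; (Fin.suc i) → f≢0 i }

  nonzeroSurjection⇒≤ : ∀ {n} (f : Fin n → Carrier) → (∀ x → x ≢ 0# → ∃ λ i → f i ≡ x) →
                        q ℕ.≤ suc n
  nonzeroSurjection⇒≤ {n} f f-surj =
    Fin.injective⇒≤ {f = λ i → index (to i)} λ eq → to-injective (index-injective eq)
    where
    index : Carrier → Fin (suc n)
    index x with x ≟ 0#
    ... | yes _   = Fin.zero
    ... | no x≢0  = Fin.suc (proj₁ (f-surj x x≢0))
    index-injective : Injective _≡_ _≡_ index
    index-injective {x} {y} eq with x ≟ 0# | y ≟ 0#
    ... | yes x≡0 | yes y≡0 = trans x≡0 (sym y≡0)
    ... | no x≢0  | no y≢0  = trans (sym (proj₂ (f-surj x x≢0)))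
                                (trans (cong f (Fin.suc-injective eq)) (proj₂ (f-surj y y≢0)))

  ^'-+ : ∀ x m n → x ^' (m ℕ.+ n) ≡ x ^' m * x ^' n
  ^'-+ x zero    n = sym (*-identityˡ _)
  ^'-+ x (suc m) n = trans (cong (x *_) (^'-+ x m n)) (sym (*-assoc _ _ _))

  ^'-distrib-* : ∀ x y n → (x * y) ^' n ≡ x ^' n * y ^' n
  ^'-distrib-* x y zero    = sym (*-identityˡ 1#)
  ^'-distrib-* x y (suc n) = trans (cong ((x * y) *_) (^'-distrib-* x y n))
    (solve 4 (λ x y a b → (x :* y) :* (a :* b) := (x :* a) :* (y :* b)) refl x y (x ^' n) (y ^' n))

  1^'n≡1 : ∀ n → 1# ^' n ≡ 1#
  1^'n≡1 zero    = refl
  1^'n≡1 (suc n) = trans (*-identityˡ _) (1^'n≡1 n)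

  ^'-* : ∀ x m n → x ^' (m ℕ.* n) ≡ (x ^' m) ^' n
  ^'-* x zero    n = sym (1^'n≡1 n)
  ^'-* x (suc m) n = trans (^'-+ x n (m ℕ.* n))
    (trans (cong (x ^' n *_) (^'-* x m n)) (sym (^'-distrib-* x (x ^' m) n)))

  ^'-nonzero : ∀ {x} n → x ≢ 0# → x ^' n ≢ 0#
  ^'-nonzero zero    x≢0 = λ 1≡0 → 0≢1 (sym 1≡0)
  ^'-nonzero (suc n) x≢0 = *-nonzero x≢0 (^'-nonzero n x≢0)

leastBelow : ∀ {p} {P : ℕ → Set p} → (∀ n → Dec (P n)) → ∀ b →
             (∃ λ m → m ℕ.< b × P m × (∀ {k} → k ℕ.< m → ¬ P k)) ⊎ (∀ {k} → k ℕ.< b → ¬ P k)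
leastBelow P? zero = inj₂ λ ()
leastBelow P? (suc b) with leastBelow P? b
... | inj₁ (m , m<b , pm , below-m) = inj₁ (m , ℕ.m<n⇒m<1+n m<b , pm , below-m)
... | inj₂ below-b with P? b
...   | yes pb = inj₁ (b , ℕ.n<1+n b , pb , below-b)
...   | no ¬pb = inj₂ λ k<1+b → [ below-b , (λ { ≡.refl → ¬pb }) ]′ (ℕ.m≤n⇒m<n∨m≡n (ℕ.s≤s⁻¹ k<1+b))

module OrderOfGenerator {q : ℕ} (F : FiniteField q) (α : FiniteField.Carrier F)
                        (α-gen : FiniteField.GeneratesQR F α) where
  open FiniteField F
  open FieldProperties F
  open Inverse enumeration using (from)
  open ≡ using (_≡_; _≢_; refl; sym; trans; cong; subst; module ≡-Reasoning)
  open ≡-Reasoning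

  ρ : Carrier
  ρ = proj₁ (proj₂ (proj₁ α-gen))

  ρ²≡α : ρ * ρ ≡ α
  ρ²≡α = proj₂ (proj₂ (proj₁ α-gen))

  α≢0 : α ≢ 0#
  α≢0 = proj₁ (proj₁ α-gen)

  ρ^²≡α^ : ∀ n → ρ ^' n * ρ ^' n ≡ α ^' n
  ρ^²≡α^ n = trans (sym (^'-distrib-* ρ ρ n)) (cong (_^' n) ρ²≡α)

  α^-QR : ∀ n → QR (α ^' n)
  α^-QR n = ^'-nonzero n α≢0 , ρ ^' n , ρ^²≡α^ n

  α^-cancel : ∀ m n → α ^' (m ℕ.+ n) ≡ α ^' m → α ^' n ≡ 1#
  α^-cancel m n eq = *-cancelˡ (^'-nonzero m α≢0) (trans (sym (^'-+ α m n)) (trans eq (sym (*-identityʳ _))))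

  period : ∃ λ d → α ^' suc d ≡ 1#
  period with Fin.pigeonhole (ℕ.n<1+n q) (λ i → from (α ^' Fin.toℕ i))
  ... | i , j , i<j , eq with ℕ.m≤n⇒∃[o]m+o≡n i<j
  ... | d , i+1+d≡j = d , α^-cancel (Fin.toℕ i) (suc d)
    (trans (cong (α ^'_) (trans (ℕ.+-suc (Fin.toℕ i) d) i+1+d≡j)) (sym (from-injective eq)))

  -- abstract, so that r does not unfold into the pigeonhole search
  abstract
    order : ∃ λ m → m ℕ.< suc (proj₁ period) × α ^' suc m ≡ 1# × (∀ {k} → k ℕ.< m → α ^' suc k ≢ 1#)
    order with leastBelow (λ d → (α ^' suc d) ≟ 1#) (suc (proj₁ period))
    ... | inj₁ least = least
    ... | inj₂ none  = ⊥-elim (none (ℕ.n<1+n _) (proj₂ period))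

  r : ℕ
  r = suc (proj₁ order)

  α^r≡1 : α ^' r ≡ 1#
  α^r≡1 = proj₁ (proj₂ (proj₂ order))

  α^i≢1 : ∀ {i} → 0 ℕ.< i → i ℕ.< r → α ^' i ≢ 1#
  α^i≢1 {suc i} _ (ℕ.s≤s i<r) = proj₂ (proj₂ (proj₂ order)) i<r

  α^[n*r]≡1 : ∀ n → α ^' (n ℕ.* r) ≡ 1#
  α^[n*r]≡1 n = begin
    α ^' (n ℕ.* r)   ≡⟨ cong (α ^'_) (ℕ.*-comm n r) ⟩
    α ^' (r ℕ.* n)   ≡⟨ ^'-* α r n ⟩
    (α ^' r) ^' n    ≡⟨ cong (_^' n) α^r≡1 ⟩
    1# ^' n          ≡⟨ 1^'n≡1 n ⟩
    1#               ∎

  α^e≡α^[e%r] : ∀ e → α ^' e ≡ α ^' (e % r)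
  α^e≡α^[e%r] e = begin
    α ^' e                                 ≡⟨ cong (α ^'_) (m≡m%n+[m/n]*n e r) ⟩
    α ^' (e % r ℕ.+ (e ℕ./ r) ℕ.* r)       ≡⟨ ^'-+ α (e % r) _ ⟩
    α ^' (e % r) * α ^' ((e ℕ./ r) ℕ.* r)  ≡⟨ cong (α ^' (e % r) *_) (α^[n*r]≡1 (e ℕ./ r)) ⟩
    α ^' (e % r) * 1#                      ≡⟨ *-identityʳ _ ⟩
    α ^' (e % r)                           ∎

  α^-injective-< : ∀ {a b} → a ℕ.< b → b ℕ.< r → α ^' b ≢ α ^' a
  α^-injective-< {a} {b} a<b b<r α^b≡α^a =
    α^i≢1 (ℕ.s≤s ℕ.z≤n) (ℕ.≤-<-trans (ℕ.m≤n+m (suc d) a) (subst (ℕ._< r) (sym a+1+d≡b) b<r))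
      (α^-cancel a (suc d) (trans (cong (α ^'_) a+1+d≡b) α^b≡α^a))
    where
    d : ℕ
    d = proj₁ (ℕ.m≤n⇒∃[o]m+o≡n a<b)
    a+1+d≡b : a ℕ.+ suc d ≡ b
    a+1+d≡b = trans (ℕ.+-suc a d) (proj₂ (ℕ.m≤n⇒∃[o]m+o≡n a<b))

  α^-injective : ∀ {a b} → a ℕ.< r → b ℕ.< r → α ^' a ≡ α ^' b → a ≡ b
  α^-injective {a} {b} a<r b<r α^a≡α^b with ℕ.<-cmp a b
  ... | tri≈ _ a≡b _ = a≡b
  ... | tri< a<b _ _ = ⊥-elim (α^-injective-< a<b b<r (sym α^a≡α^b))
  ... | tri> _ _ b<a = ⊥-elim (α^-injective-< b<a a<r α^a≡α^b)

  α^≡α^⇒%≡ : ∀ {a b} → α ^' a ≡ α ^' b → a % r ≡ b % r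
  α^≡α^⇒%≡ {a} {b} α^a≡α^b = α^-injective (m%n<n a r) (m%n<n b r)
    (trans (sym (α^e≡α^[e%r] a)) (trans α^a≡α^b (α^e≡α^[e%r] b)))

  nonzero≡±ρ^ : ∀ x → x ≢ 0# → ∃ λ i → i ℕ.< r × (x ≡ ρ ^' i ⊎ x ≡ - ρ ^' i)
  nonzero≡±ρ^ x x≢0 with proj₂ α-gen (x * x) (QR-square x≢0)
  ... | e , α^e≡x² = e % r , m%n<n e r ,
    x²≡y²⇒x≡±y (trans (sym α^e≡x²) (trans (α^e≡α^[e%r] e) (sym (ρ^²≡α^ (e % r)))))

module SquareClasses {q : ℕ} (F : FiniteField q) (α : FiniteField.Carrier F)
                (α-gen : FiniteField.GeneratesQR F α)
                (s : ℕ) (q≡1+2s : q ≡ suc (s ℕ.+ s)) (0<s : 0 ℕ.< s) where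
  open FiniteField F
  open FieldProperties F
  open OrderOfGenerator F α α-gen
  open ≡ using (_≡_; _≢_; refl; sym; trans; cong; subst; module ≡-Reasoning)
  open ≡-Reasoning

  α^-injectiveFin : Injective _≡_ _≡_ (λ (i : Fin r) → α ^' Fin.toℕ i)
  α^-injectiveFin {i} {j} eq = Fin.toℕ-injective (α^-injective (Fin.toℕ<n i) (Fin.toℕ<n j) eq)

  r<q : r ℕ.< q
  r<q = nonzeroInjection⇒< (λ i → α ^' Fin.toℕ i) α^-injectiveFin (λ i → ^'-nonzero (Fin.toℕ i) α≢0)

  -- in characteristic 2 every nonzero x = ±ρ^i would be a power of ρ, so q = r + 1 and
  -- r = 2s; then (α^s)² = 1 forces α^s = ±1 = 1, contradicting the minimality of r
  1+1≢0 : 1# + 1# ≢ 0#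
  1+1≢0 2≡0 = α^i≢1 0<s s<r α^s≡1
    where
    -x≡x : ∀ x → - x ≡ x
    -x≡x x = begin
      - x                    ≡⟨ +-identityʳ (- x) ⟨
      - x + 0#               ≡⟨ cong (- x +_) (trans (cong (_* x) 2≡0) (zeroˡ x)) ⟨
      - x + (1# + 1#) * x    ≡⟨ solve 1 (λ x → :- x :+ (:1 :+ :1) :* x := x) refl x ⟩
      x                      ∎
    ±y≡x⇒y≡x : ∀ {x y} → x ≡ y ⊎ x ≡ - y → y ≡ x
    ±y≡x⇒y≡x (inj₁ x≡y)  = sym x≡y
    ±y≡x⇒y≡x (inj₂ x≡-y) = sym (trans x≡-y (-x≡x _))
    q≤1+r : q ℕ.≤ suc r
    q≤1+r = nonzeroSurjection⇒≤ (λ i → ρ ^' Fin.toℕ i) λ x x≢0 →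
      let i , i<r , x≡±ρ^i = nonzero≡±ρ^ x x≢0 in
      Fin.fromℕ< i<r , trans (cong (ρ ^'_) (Fin.toℕ-fromℕ< i<r)) (±y≡x⇒y≡x x≡±ρ^i)
    r≡s+s : r ≡ s ℕ.+ s
    r≡s+s = ℕ.suc-injective (trans (sym (ℕ.≤-antisym q≤1+r r<q)) q≡1+2s)
    s<r : s ℕ.< r
    s<r = subst (s ℕ.<_) (sym r≡s+s) (ℕ.m<m+n s 0<s)
    α^s≡1 : α ^' s ≡ 1#
    α^s≡1 = sym (±y≡x⇒y≡x (x²≡y²⇒x≡±y (begin
      α ^' s * α ^' s    ≡⟨ ^'-+ α s s ⟨
      α ^' (s ℕ.+ s)     ≡⟨ cong (α ^'_) r≡s+s ⟨
      α ^' r             ≡⟨ α^r≡1 ⟩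
      1#                 ≡⟨ *-identityˡ 1# ⟨
      1# * 1#            ∎)))

  x≢-x : ∀ {x} → x ≢ 0# → x ≢ - x
  x≢-x {x} x≢0 x≡-x = *-nonzero 1+1≢0 x≢0 (begin
    (1# + 1#) * x   ≡⟨ solve 1 (λ x → (:1 :+ :1) :* x := x :+ x) refl x ⟩
    x + x           ≡⟨ cong (x +_) x≡-x ⟩
    x - x           ≡⟨ -‿inverseʳ x ⟩
    0#              ∎)

  ∘splitAt-injective : ∀ {g : Fin r ⊎ Fin r → Carrier} → Injective _≡_ _≡_ g →
                       Injective _≡_ _≡_ (λ i → g (Fin.splitAt r i))
  ∘splitAt-injective g-inj {i} {j} eq =
    trans (sym (Fin.join-splitAt r r i)) (trans (cong (Fin.join r r) (g-inj eq)) (Fin.join-splitAt r r j))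

  ∘splitAt-hits : ∀ (g : Fin r ⊎ Fin r → Carrier) {x} a → g a ≡ x → ∃ λ i → g (Fin.splitAt r i) ≡ x
  ∘splitAt-hits g a ga≡x = Fin.join r r a , trans (cong g (Fin.splitAt-join r r a)) ga≡x

  ±ρ^ : Fin r ⊎ Fin r → Carrier
  ±ρ^ (inj₁ i) = ρ ^' Fin.toℕ i
  ±ρ^ (inj₂ i) = - ρ ^' Fin.toℕ i

  ρ^-nonzero : ∀ n → ρ ^' n ≢ 0#
  ρ^-nonzero n = *-nonzeroˡ (subst (_≢ 0#) (sym (ρ^²≡α^ n)) (^'-nonzero n α≢0))

  ρ^²-injective : ∀ {i j : Fin r} → ρ ^' Fin.toℕ i * ρ ^' Fin.toℕ i ≡ ρ ^' Fin.toℕ j * ρ ^' Fin.toℕ j → i ≡ j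
  ρ^²-injective {i} {j} eq =
    α^-injectiveFin (trans (sym (ρ^²≡α^ (Fin.toℕ i))) (trans eq (ρ^²≡α^ (Fin.toℕ j))))

  ρ^≢-ρ^ : ∀ (i j : Fin r) → ρ ^' Fin.toℕ i ≢ - ρ ^' Fin.toℕ j
  ρ^≢-ρ^ i j eq = x≢-x (ρ^-nonzero (Fin.toℕ i)) (trans eq (cong (λ k → - ρ ^' Fin.toℕ k) (sym i≡j)))
    where
    i≡j : i ≡ j
    i≡j = ρ^²-injective (trans (cong (λ z → z * z) eq) (-x*-y≡x*y _ _))

  ±ρ^-injective : Injective _≡_ _≡_ ±ρ^
  ±ρ^-injective {inj₁ i} {inj₁ j} eq = cong inj₁ (ρ^²-injective (cong (λ z → z * z) eq))
  ±ρ^-injective {inj₂ i} {inj₂ j} eq = cong inj₂ (ρ^²-injective (cong (λ z → z * z) (-‿injective eq)))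
  ±ρ^-injective {inj₁ i} {inj₂ j} eq = ⊥-elim (ρ^≢-ρ^ i j eq)
  ±ρ^-injective {inj₂ i} {inj₁ j} eq = ⊥-elim (ρ^≢-ρ^ j i (sym eq))

  ±ρ^-nonzero : ∀ a → ±ρ^ a ≢ 0#
  ±ρ^-nonzero (inj₁ i) = ρ^-nonzero (Fin.toℕ i)
  ±ρ^-nonzero (inj₂ i) = -‿nonzero (ρ^-nonzero (Fin.toℕ i))

  q≡1+2r : q ≡ suc (r ℕ.+ r)
  q≡1+2r = ℕ.≤-antisym
    (nonzeroSurjection⇒≤ (λ i → ±ρ^ (Fin.splitAt r i)) λ x x≢0 → hit (nonzero≡±ρ^ x x≢0))
    (nonzeroInjection⇒< (λ i → ±ρ^ (Fin.splitAt r i)) (∘splitAt-injective ±ρ^-injective)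
      (λ i → ±ρ^-nonzero (Fin.splitAt r i)))
    where
    hit : ∀ {x} → (∃ λ i → i ℕ.< r × (x ≡ ρ ^' i ⊎ x ≡ - ρ ^' i)) → ∃ λ j → ±ρ^ (Fin.splitAt r j) ≡ x
    hit (i , i<r , inj₁ x≡ρ^i)  = ∘splitAt-hits ±ρ^ (inj₁ (Fin.fromℕ< i<r))
      (trans (cong (ρ ^'_) (Fin.toℕ-fromℕ< i<r)) (sym x≡ρ^i))
    hit (i , i<r , inj₂ x≡-ρ^i) = ∘splitAt-hits ±ρ^ (inj₂ (Fin.fromℕ< i<r))
      (trans (cong (λ n → - ρ ^' n) (Fin.toℕ-fromℕ< i<r)) (sym x≡-ρ^i))

  r≡s : r ≡ s
  r≡s = half (ℕ.suc-injective (trans (sym q≡1+2r) q≡1+2s))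
    where
    half : ∀ {m n} → m ℕ.+ m ≡ n ℕ.+ n → m ≡ n
    half {m} {n} eq with ℕ.<-cmp m n
    ... | tri≈ _ m≡n _ = m≡n
    ... | tri< m<n _ _ = ⊥-elim (ℕ.<-irrefl eq (ℕ.+-mono-< m<n m<n))
    ... | tri> _ _ n<m = ⊥-elim (ℕ.<-irrefl (sym eq) (ℕ.+-mono-< n<m n<m))

  -- the 2r elements α^i and b α^i are distinct and nonzero, hence exhaust F*; so a = b α^i
  NQR*NQR⇒QR : ∀ {a b} → NQR a → NQR b → QR (a * b)
  NQR*NQR⇒QR {a} {b} a∈NQR b∈NQR@(b≢0 , _) = classify (nonzeroInjection-surjective
    (λ j → cosets (Fin.splitAt r j)) (∘splitAt-injective cosets-injective)
    (λ j → cosets-nonzero (Fin.splitAt r j)) q≡1+2r a (proj₁ a∈NQR))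
    where
    cosets : Fin r ⊎ Fin r → Carrier
    cosets (inj₁ i) = α ^' Fin.toℕ i
    cosets (inj₂ i) = b * α ^' Fin.toℕ i

    b*α^-NQR : ∀ n → NQR (b * α ^' n)
    b*α^-NQR n = subst NQR (*-comm _ _) (QR*NQR⇒NQR (α^-QR n) b∈NQR)

    cosets-injective : Injective _≡_ _≡_ cosets
    cosets-injective {inj₁ i} {inj₁ j} eq = cong inj₁ (α^-injectiveFin eq)
    cosets-injective {inj₂ i} {inj₂ j} eq = cong inj₂ (α^-injectiveFin (*-cancelˡ b≢0 eq))
    cosets-injective {inj₁ i} {inj₂ j} eq = ⊥-elim (QR≢NQR (α^-QR (Fin.toℕ i)) (b*α^-NQR (Fin.toℕ j)) eq)
    cosets-injective {inj₂ i} {inj₁ j} eq =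
      ⊥-elim (QR≢NQR (α^-QR (Fin.toℕ j)) (b*α^-NQR (Fin.toℕ i)) (sym eq))

    cosets-nonzero : ∀ c → cosets c ≢ 0#
    cosets-nonzero (inj₁ i) = ^'-nonzero (Fin.toℕ i) α≢0
    cosets-nonzero (inj₂ i) = proj₁ (b*α^-NQR (Fin.toℕ i))

    case : ∀ c → cosets c ≡ a → QR (a * b)
    case (inj₁ i) α^i≡a  = ⊥-elim (QR≢NQR (α^-QR (Fin.toℕ i)) a∈NQR α^i≡a)
    case (inj₂ i) bα^i≡a = subst QR (begin
      (b * b) * α ^' Fin.toℕ i   ≡⟨ solve 2 (λ b w → (b :* b) :* w := (b :* w) :* b) refl b _ ⟩
      (b * α ^' Fin.toℕ i) * b   ≡⟨ cong (_* b) bα^i≡a ⟩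
      a * b                      ∎) (QR-* (QR-square b≢0) (α^-QR (Fin.toℕ i)))

    classify : (∃ λ j → cosets (Fin.splitAt r j) ≡ a) → QR (a * b)
    classify (j , eq) = case (Fin.splitAt r j) eq

module Cosets {q : ℕ} (F : FiniteField q) (α : FiniteField.Carrier F)
              (α-gen : FiniteField.GeneratesQR F α) (k₂ u : ℕ)
              (q≡2^k*t+1 : q ≡ 2 ℕ.^ suc (suc k₂) ℕ.* suc (u ℕ.+ u) ℕ.+ 1) where
  open FiniteField F
  open FieldProperties F
  open OrderOfGenerator F α α-gen
  open Construction (suc (suc k₂)) α
  open ≡ using (_≡_; _≢_; refl; sym; trans; cong; cong₂; subst; module ≡-Reasoning)
  open ≡-Reasoning

  h t m : ℕ
  h = 2 ℕ.^ k₂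
  t = suc (u ℕ.+ u)
  m = 2 ℕ.* h

  g : Carrier
  g = α ^' m

  0<h : 0 ℕ.< h
  0<h = ℕ.m^n>0 2 k₂

  instance
    m-nonZero : ℕ.NonZero m
    m-nonZero = ℕ.>-nonZero (ℕ.*-monoʳ-< 2 0<h)

  0<ht : 0 ℕ.< h ℕ.* t
  0<ht = ℕ.*-mono-< 0<h (ℕ.s≤s ℕ.z≤n)

  q≡1+[mt+mt] : q ≡ suc (m ℕ.* t ℕ.+ m ℕ.* t)
  q≡1+[mt+mt] = trans q≡2^k*t+1 (identity h t)
    where
    identity : ∀ h t → 2 ℕ.* (2 ℕ.* h) ℕ.* t ℕ.+ 1 ≡ suc (2 ℕ.* h ℕ.* t ℕ.+ 2 ℕ.* h ℕ.* t)
    identity = solve-∀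

  open SquareClasses F α α-gen (m ℕ.* t) q≡1+[mt+mt] (ℕ.*-mono-< (ℕ.*-monoʳ-< 2 0<h) (ℕ.s≤s ℕ.z≤n))
    using (NQR*NQR⇒QR; x≢-x) renaming (r≡s to r≡m*t)

  r≡ht+ht : r ≡ h ℕ.* t ℕ.+ h ℕ.* t
  r≡ht+ht = trans r≡m*t (identity h t)
    where
    identity : ∀ h t → 2 ℕ.* h ℕ.* t ≡ h ℕ.* t ℕ.+ h ℕ.* t
    identity = solve-∀

  α^[ht]≡-1 : α ^' (h ℕ.* t) ≡ - 1#
  α^[ht]≡-1 = [ (λ α^ht≡1 → ⊥-elim (α^i≢1 0<ht ht<r α^ht≡1)) , (λ α^ht≡-1 → α^ht≡-1) ]′
    (x²≡y²⇒x≡±y (begin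
      α ^' (h ℕ.* t) * α ^' (h ℕ.* t)   ≡⟨ ^'-+ α (h ℕ.* t) (h ℕ.* t) ⟨
      α ^' (h ℕ.* t ℕ.+ h ℕ.* t)        ≡⟨ cong (α ^'_) r≡ht+ht ⟨
      α ^' r                            ≡⟨ α^r≡1 ⟩
      1#                                ≡⟨ *-identityˡ 1# ⟨
      1# * 1#                           ∎))
    where
    ht<r : h ℕ.* t ℕ.< r
    ht<r = subst (h ℕ.* t ℕ.<_) (sym r≡ht+ht) (ℕ.m<m+n (h ℕ.* t) 0<ht)

  -x≡α^[ht]*x : ∀ x → - x ≡ α ^' (h ℕ.* t) * x
  -x≡α^[ht]*x x = trans (sym (-1*x≈-x x)) (cong (_* x) (sym α^[ht]≡-1))

  -1∈QR : QR (- 1#)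
  -1∈QR = subst QR α^[ht]≡-1 (α^-QR (h ℕ.* t))

  g^i≡α^[m*i] : ∀ i → g ^' i ≡ α ^' (m ℕ.* i)
  g^i≡α^[m*i] i = sym (^'-* α m i)

  g^t≡1 : g ^' t ≡ 1#
  g^t≡1 = trans (g^i≡α^[m*i] t) (trans (cong (α ^'_) (sym r≡m*t)) α^r≡1)

  g^i*g^[2u*i]≡1 : ∀ i → g ^' i * g ^' ((u ℕ.+ u) ℕ.* i) ≡ 1#
  g^i*g^[2u*i]≡1 i = begin
    g ^' i * g ^' ((u ℕ.+ u) ℕ.* i)   ≡⟨ ^'-+ g i _ ⟨
    g ^' (t ℕ.* i)                    ≡⟨ ^'-* g t i ⟩
    (g ^' t) ^' i                     ≡⟨ cong (_^' i) g^t≡1 ⟩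
    1# ^' i                           ≡⟨ 1^'n≡1 i ⟩
    1#                                ∎

  ⋃C ⋃Ĉ : Carrier → Set
  ⋃C x = ∃[ j ] (j ℕ.< h × C j x)
  ⋃Ĉ x = ∃[ j ] (j ℕ.< h × Ĉ j x)

  α^j*g^i≡α^[j+m*i] : ∀ j i → α ^' j * g ^' i ≡ α ^' (j ℕ.+ m ℕ.* i)
  α^j*g^i≡α^[j+m*i] j i = trans (cong (α ^' j *_) (g^i≡α^[m*i] i)) (sym (^'-+ α j (m ℕ.* i)))

  C-exponent : ∀ {j x} → C j x → ∃ λ i → x ≡ α ^' (j ℕ.+ m ℕ.* i)
  C-exponent {j} (c , (i , c≡g^i) , x≡α^j*c) =
    i , trans x≡α^j*c (trans (cong (α ^' j *_) c≡g^i) (α^j*g^i≡α^[j+m*i] j i))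

  <h⇒<m : ∀ {j} → j ℕ.< h → j ℕ.< m
  <h⇒<m j<h = ℕ.<-≤-trans j<h (ℕ.m≤m+n h _)

  <h⇒h+<m : ∀ {j} → j ℕ.< h → h ℕ.+ j ℕ.< m
  <h⇒h+<m j<h = ℕ.+-monoʳ-< h (ℕ.<-≤-trans j<h (ℕ.m≤m+n h 0))

  [j+m*i]%m≡j : ∀ {j} i → j ℕ.< m → (j ℕ.+ m ℕ.* i) % m ≡ j
  [j+m*i]%m≡j {j} i j<m =
    trans (cong (λ n → (j ℕ.+ n) % m) (ℕ.*-comm m i)) (trans ([m+kn]%n≡m%n j i m) (m<n⇒m%n≡m j<m))

  ht+[j+m*i]≡h+j+m*[u+i] : ∀ j i → h ℕ.* t ℕ.+ (j ℕ.+ m ℕ.* i) ≡ (h ℕ.+ j) ℕ.+ m ℕ.* (u ℕ.+ i)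
  ht+[j+m*i]≡h+j+m*[u+i] j i = identity h u j i
    where
    identity : ∀ h u j i →
      h ℕ.* suc (u ℕ.+ u) ℕ.+ (j ℕ.+ 2 ℕ.* h ℕ.* i) ≡ (h ℕ.+ j) ℕ.+ 2 ℕ.* h ℕ.* (u ℕ.+ i)
    identity = solve-∀

  m∣r : m ∣ r
  m∣r = divides t (trans r≡m*t (ℕ.*-comm m t))

  -- residues modulo m = 2h separate the C_j (j < h) from Ĉ_j = α^(ht) C_j
  α^[j+m*i]≢α^[ht+j′+m*i′] : ∀ {j j′} i i′ → j ℕ.< h → j′ ℕ.< h →
                             α ^' (j ℕ.+ m ℕ.* i) ≢ α ^' (h ℕ.* t ℕ.+ (j′ ℕ.+ m ℕ.* i′))
  α^[j+m*i]≢α^[ht+j′+m*i′] {j} {j′} i i′ j<h j′<h eq =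
    ℕ.<-irrefl refl (ℕ.<-≤-trans j<h (subst (h ℕ.≤_) (sym j≡h+j′) (ℕ.m≤m+n h j′)))
    where
    a b : ℕ
    a = j ℕ.+ m ℕ.* i
    b = h ℕ.* t ℕ.+ (j′ ℕ.+ m ℕ.* i′)
    j≡h+j′ : j ≡ h ℕ.+ j′
    j≡h+j′ = begin
      j                                           ≡⟨ [j+m*i]%m≡j i (<h⇒<m j<h) ⟨
      a % m                                       ≡⟨ m∣n⇒o%n%m≡o%m m r a m∣r ⟨
      (a % r) % m                                 ≡⟨ cong (_% m) (α^≡α^⇒%≡ {a} {b} eq) ⟩
      (b % r) % m                                 ≡⟨ m∣n⇒o%n%m≡o%m m r b m∣r ⟩
      (h ℕ.* t ℕ.+ (j′ ℕ.+ m ℕ.* i′)) % m         ≡⟨ cong (_% m) (ht+[j+m*i]≡h+j+m*[u+i] j′ i′) ⟩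
      (h ℕ.+ j′ ℕ.+ m ℕ.* (u ℕ.+ i′)) % m         ≡⟨ [j+m*i]%m≡j (u ℕ.+ i′) (<h⇒h+<m j′<h) ⟩
      h ℕ.+ j′                                    ∎

  ⋃C-⋃Ĉ-disjoint : ∀ {x} → ⋃C x → ⋃Ĉ x → ⊥
  ⋃C-⋃Ĉ-disjoint {x} (j , j<h , x∈Cj) (j′ , j′<h , c , c∈Cj′ , x≡-c) =
    let i , x≡α^[j+mi] = C-exponent {j} x∈Cj ; i′ , c≡α^[j′+mi′] = C-exponent {j′} c∈Cj′ in
    α^[j+m*i]≢α^[ht+j′+m*i′] i i′ j<h j′<h (begin
      α ^' (j ℕ.+ m ℕ.* i)                        ≡⟨ x≡α^[j+mi] ⟨
      x                                           ≡⟨ x≡-c ⟩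
      - c                                         ≡⟨ -x≡α^[ht]*x c ⟩
      α ^' (h ℕ.* t) * c                          ≡⟨ cong (α ^' (h ℕ.* t) *_) c≡α^[j′+mi′] ⟩
      α ^' (h ℕ.* t) * α ^' (j′ ℕ.+ m ℕ.* i′)     ≡⟨ ^'-+ α (h ℕ.* t) _ ⟨
      α ^' (h ℕ.* t ℕ.+ (j′ ℕ.+ m ℕ.* i′))        ∎)

  α^e∈⋃C : ∀ e → e % m ℕ.< h → ⋃C (α ^' e)
  α^e∈⋃C e e%m<h = e % m , e%m<h , g ^' (e ℕ./ m) , (e ℕ./ m , refl) , (begin
    α ^' e                                   ≡⟨ cong (α ^'_) (m≡m%n+[m/n]*n e m) ⟩
    α ^' (e % m ℕ.+ e ℕ./ m ℕ.* m)           ≡⟨ cong (λ n → α ^' (e % m ℕ.+ n)) (ℕ.*-comm (e ℕ./ m) m) ⟩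
    α ^' (e % m ℕ.+ m ℕ.* (e ℕ./ m))         ≡⟨ α^j*g^i≡α^[j+m*i] (e % m) (e ℕ./ m) ⟨
    α ^' (e % m) * g ^' (e ℕ./ m)            ∎)

  α^e∈⋃Ĉ : ∀ e → h ℕ.≤ e % m → ⋃Ĉ (α ^' e)
  α^e∈⋃Ĉ e h≤e%m = j , j<h , α ^' j * g ^' i , (g ^' i , (i , refl) , refl) , sym (begin
    - (α ^' j * g ^' i)                     ≡⟨ -x≡α^[ht]*x _ ⟩
    α ^' (h ℕ.* t) * (α ^' j * g ^' i)      ≡⟨ cong (α ^' (h ℕ.* t) *_) (α^j*g^i≡α^[j+m*i] j i) ⟩
    α ^' (h ℕ.* t) * α ^' (j ℕ.+ m ℕ.* i)   ≡⟨ ^'-+ α (h ℕ.* t) _ ⟨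
    α ^' (h ℕ.* t ℕ.+ (j ℕ.+ m ℕ.* i))      ≡⟨ cong (α ^'_) exponent ⟩
    α ^' (e ℕ.+ r)                          ≡⟨ ^'-+ α e r ⟩
    α ^' e * α ^' r                         ≡⟨ cong (α ^' e *_) α^r≡1 ⟩
    α ^' e * 1#                             ≡⟨ *-identityʳ _ ⟩
    α ^' e                                  ∎)
    where
    i j : ℕ
    i = e ℕ./ m ℕ.+ suc u
    j = e % m ℕ.∸ h
    h+j≡e%m : h ℕ.+ j ≡ e % m
    h+j≡e%m = ℕ.m+[n∸m]≡n h≤e%m
    j<h : j ℕ.< h
    j<h = ℕ.+-cancelˡ-< h j h (subst (ℕ._< h ℕ.+ h) (sym h+j≡e%m)
      (subst (e % m ℕ.<_) (cong (h ℕ.+_) (ℕ.+-identityʳ h)) (m%n<n e m)))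
    identity : ∀ h u a b →
      a ℕ.+ 2 ℕ.* h ℕ.* (u ℕ.+ (b ℕ.+ suc u)) ≡ (a ℕ.+ b ℕ.* (2 ℕ.* h)) ℕ.+ 2 ℕ.* h ℕ.* suc (u ℕ.+ u)
    identity = solve-∀
    exponent : h ℕ.* t ℕ.+ (j ℕ.+ m ℕ.* i) ≡ e ℕ.+ r
    exponent = begin
      h ℕ.* t ℕ.+ (j ℕ.+ m ℕ.* i)               ≡⟨ ht+[j+m*i]≡h+j+m*[u+i] j i ⟩
      (h ℕ.+ j) ℕ.+ m ℕ.* (u ℕ.+ i)             ≡⟨ identity h u (h ℕ.+ j) (e ℕ./ m) ⟩
      (h ℕ.+ j ℕ.+ e ℕ./ m ℕ.* m) ℕ.+ m ℕ.* t   ≡⟨ cong (λ n → n ℕ.+ e ℕ./ m ℕ.* m ℕ.+ m ℕ.* t) h+j≡e%m ⟩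
      (e % m ℕ.+ e ℕ./ m ℕ.* m) ℕ.+ m ℕ.* t     ≡⟨ cong₂ ℕ._+_ (m≡m%n+[m/n]*n e m) r≡m*t ⟨
      e ℕ.+ r                                   ∎

  QR⇒⋃C⊎⋃Ĉ : ∀ {x} → QR x → ⋃C x ⊎ ⋃Ĉ x
  QR⇒⋃C⊎⋃Ĉ x∈QR with proj₂ α-gen _ x∈QR
  ... | e , refl with e % m ℕ.<? h
  ...   | yes e%m<h = inj₁ (α^e∈⋃C e e%m<h)
  ...   | no  e%m≮h = inj₂ (α^e∈⋃Ĉ e (ℕ.≮⇒≥ e%m≮h))

  ⋃C⇒QR : ∀ {x} → ⋃C x → QR x
  ⋃C⇒QR (j , _ , x∈Cj) = let i , x≡α^[j+mi] = C-exponent {j} x∈Cj in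
    subst QR (sym x≡α^[j+mi]) (α^-QR (j ℕ.+ m ℕ.* i))

  ⋃Ĉ⇒QR : ∀ {x} → ⋃Ĉ x → QR x
  ⋃Ĉ⇒QR (j , j<h , c , c∈Cj , x≡-c) =
    subst QR (sym (trans x≡-c (-x≡α^[ht]*x c))) (QR-* (α^-QR (h ℕ.* t)) (⋃C⇒QR (j , j<h , c∈Cj)))

  ⋃Ĉ⇒-⋃C : ∀ {x} → ⋃Ĉ x → ⋃C (- x)
  ⋃Ĉ⇒-⋃C (j , j<h , c , c∈Cj , x≡-c) =
    j , j<h , subst (C j) (sym (trans (cong -_ x≡-c) (-‿involutive c))) c∈Cj

  ⋃C⇒-⋃Ĉ : ∀ {x} → ⋃C x → ⋃Ĉ (- x)
  ⋃C⇒-⋃Ĉ {x} (j , j<h , x∈Cj) = j , j<h , x , x∈Cj , refl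

  C-*g^ : ∀ {j c} i → C j c → C j (c * g ^' i)
  C-*g^ i (c₀ , (i₀ , c₀≡g^i₀) , c≡α^j*c₀) =
    c₀ * g ^' i , (i₀ ℕ.+ i , trans (cong (_* g ^' i) c₀≡g^i₀) (sym (^'-+ g i₀ i))) ,
    trans (cong (_* g ^' i) c≡α^j*c₀) (*-assoc _ _ _)

  ⋃Ĉ-*g^ : ∀ {x} i → ⋃Ĉ x → ⋃Ĉ (x * g ^' i)
  ⋃Ĉ-*g^ i (j , j<h , c , c∈Cj , x≡-c) = j , j<h , c * g ^' i , C-*g^ {j} i c∈Cj ,
    trans (cong (_* g ^' i) x≡-c) (solve 2 (λ c w → :- c :* w := :- (c :* w)) refl c (g ^' i))

  1∈⋃C : ⋃C 1#
  1∈⋃C = 0 , 0<h , 1# , (0 , refl) , sym (*-identityˡ 1#)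

  g^i≢-1 : ∀ i → g ^' i ≢ - 1#
  g^i≢-1 i g^i≡-1 =
    ⋃C-⋃Ĉ-disjoint (0 , 0<h , g ^' i , (i , refl) , sym (*-identityˡ _))
      (subst ⋃Ĉ (sym g^i≡-1) (⋃C⇒-⋃Ĉ 1∈⋃C))

  -g^i∈Ĉ₀ : ∀ i → Ĉ 0 (- g ^' i)
  -g^i∈Ĉ₀ i = g ^' i , (g ^' i , (i , refl) , sym (*-identityˡ _)) , refl

  Ĉ₀-exponent : ∀ {c} → Ĉ 0 c → ∃ λ i → c ≡ - g ^' i
  Ĉ₀-exponent (c′ , (c₀ , (i , c₀≡g^i) , c′≡1*c₀) , c≡-c′) =
    i , trans c≡-c′ (cong -_ (trans c′≡1*c₀ (trans (*-identityˡ c₀) c₀≡g^i)))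

  module Starter (γ₁ γ₂ : Carrier) (γ₁∈NQR : NQR γ₁) (γ₂∈γ₁Ĉ₀ : ∃[ c ] (Ĉ 0 c × γ₂ ≡ γ₁ * c))
                 (H₁ : NQR ((γ₁ - 1#) * (γ₂ + 1#))) (H₂ : NQR ((γ₁ + 1#) * (γ₂ - 1#))) where

    i₀ : ℕ
    i₀ = proj₁ (Ĉ₀-exponent (proj₁ (proj₂ γ₂∈γ₁Ĉ₀)))

    G : Carrier
    G = g ^' i₀

    G∈QR : QR G
    G∈QR = subst QR (sym (g^i≡α^[m*i] i₀)) (α^-QR (m ℕ.* i₀))

    G≢0 : G ≢ 0#
    G≢0 = proj₁ G∈QR

    γ₁≢0 : γ₁ ≢ 0#
    γ₁≢0 = proj₁ γ₁∈NQR

    -γ₂y≡γ₁Gy : ∀ y → - (γ₂ * y) ≡ γ₁ * (G * y)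
    -γ₂y≡γ₁Gy y = begin
      - (γ₂ * y)            ≡⟨ cong (λ z → - (z * y)) (trans (proj₂ (proj₂ γ₂∈γ₁Ĉ₀))
                                 (cong (γ₁ *_) (proj₂ (Ĉ₀-exponent (proj₁ (proj₂ γ₂∈γ₁Ĉ₀)))))) ⟩
      - ((γ₁ * - G) * y)    ≡⟨ solve 3 (λ a b y → :- ((a :* :- b) :* y) := a :* (b :* y)) refl γ₁ G y ⟩
      γ₁ * (G * y)          ∎

    γ₁*QR⇒NQR : ∀ {x} → QR x → NQR (γ₁ * x)
    γ₁*QR⇒NQR x∈QR = subst NQR (*-comm _ _) (QR*NQR⇒NQR x∈QR γ₁∈NQR)

    -γ₂*QR⇒NQR : ∀ {y} → QR y → NQR (- (γ₂ * y))
    -γ₂*QR⇒NQR {y} y∈QR = subst NQR (sym (-γ₂y≡γ₁Gy y)) (γ₁*QR⇒NQR (QR-* G∈QR y∈QR))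

    G⁻¹ : Carrier
    G⁻¹ = g ^' ((u ℕ.+ u) ℕ.* i₀)

    G*G⁻¹≡1 : G * G⁻¹ ≡ 1#
    G*G⁻¹≡1 = g^i*g^[2u*i]≡1 i₀

    1+γ₁≢0 : 1# + γ₁ ≢ 0#
    1+γ₁≢0 1+γ₁≡0 = *-nonzeroˡ (proj₁ H₂) (trans (+-comm γ₁ 1#) 1+γ₁≡0)

    1-γ₂≢0 : 1# - γ₂ ≢ 0#
    1-γ₂≢0 1-γ₂≡0 = -‿nonzero (*-nonzeroʳ (proj₁ H₂))
      (trans (solve 1 (λ b → :- (b :- :1) := :1 :- b) refl γ₂) 1-γ₂≡0)

    1-γ₁≢0 : 1# - γ₁ ≢ 0#
    1-γ₁≢0 1-γ₁≡0 = -‿nonzero (*-nonzeroˡ (proj₁ H₁))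
      (trans (solve 1 (λ a → :- (a :- :1) := :1 :- a) refl γ₁) 1-γ₁≡0)

    1+γ₂≢0 : 1# + γ₂ ≢ 0#
    1+γ₂≢0 1+γ₂≡0 = *-nonzeroʳ (proj₁ H₁) (trans (+-comm γ₂ 1#) 1+γ₂≡0)

    data Forward (x y : Carrier) : Set where
      C-pair : ⋃C x → y ≡ γ₁ * x → Forward x y
      Ĉ-pair : ⋃Ĉ x → y ≡ - (γ₂ * x) → Forward x y

    PairView : Carrier → Carrier → Set
    PairView x y = Forward x y ⊎ Forward y x

    view : ∀ {x y} → S γ₁ γ₂ x y → PairView x y
    view (j , j<h , inj₁ (_ , x∈Cj , inj₁ (refl , y≡))) = inj₁ (C-pair (j , j<h , x∈Cj) y≡)
    view (j , j<h , inj₁ (_ , y∈Cj , inj₂ (x≡ , refl))) = inj₂ (C-pair (j , j<h , y∈Cj) x≡)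
    view (j , j<h , inj₂ (_ , x∈Ĉj , inj₁ (refl , y≡))) = inj₁ (Ĉ-pair (j , j<h , x∈Ĉj) y≡)
    view (j , j<h , inj₂ (_ , y∈Ĉj , inj₂ (x≡ , refl))) = inj₂ (Ĉ-pair (j , j<h , y∈Ĉj) x≡)

    unview : ∀ {x y} → PairView x y → S γ₁ γ₂ x y
    unview (inj₁ (C-pair (j , j<h , x∈Cj) y≡)) = j , j<h , inj₁ (_ , x∈Cj , inj₁ (refl , y≡))
    unview (inj₂ (C-pair (j , j<h , y∈Cj) x≡)) = j , j<h , inj₁ (_ , y∈Cj , inj₂ (x≡ , refl))
    unview (inj₁ (Ĉ-pair (j , j<h , x∈Ĉj) y≡)) = j , j<h , inj₂ (_ , x∈Ĉj , inj₁ (refl , y≡))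
    unview (inj₂ (Ĉ-pair (j , j<h , y∈Ĉj) x≡)) = j , j<h , inj₂ (_ , y∈Ĉj , inj₂ (x≡ , refl))

    forward-QR-NQR : ∀ {x y} → Forward x y → QR x × NQR y
    forward-QR-NQR (C-pair x∈⋃C y≡) = ⋃C⇒QR x∈⋃C , subst NQR (sym y≡) (γ₁*QR⇒NQR (⋃C⇒QR x∈⋃C))
    forward-QR-NQR (Ĉ-pair x∈⋃Ĉ y≡) = ⋃Ĉ⇒QR x∈⋃Ĉ , subst NQR (sym y≡) (-γ₂*QR⇒NQR (⋃Ĉ⇒QR x∈⋃Ĉ))

    nonzero : ∀ {x y} → PairView x y → x ≢ 0#
    nonzero (inj₁ f) = proj₁ (proj₁ (forward-QR-NQR f))
    nonzero (inj₂ f) = proj₁ (proj₂ (forward-QR-NQR f))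

    distinct : ∀ {x y} → PairView x y → x ≢ y
    distinct (inj₁ f) x≡y = let x∈QR , y∈NQR = forward-QR-NQR f in QR≢NQR x∈QR y∈NQR x≡y
    distinct (inj₂ f) x≡y = let y∈QR , x∈NQR = forward-QR-NQR f in QR≢NQR y∈QR x∈NQR (sym x≡y)

    forward-unique : ∀ {x y z} → Forward x y → Forward x z → y ≡ z
    forward-unique (C-pair _ y≡) (C-pair _ z≡) = trans y≡ (sym z≡)
    forward-unique (Ĉ-pair _ y≡) (Ĉ-pair _ z≡) = trans y≡ (sym z≡)
    forward-unique (C-pair x∈⋃C _) (Ĉ-pair x∈⋃Ĉ _) = ⊥-elim (⋃C-⋃Ĉ-disjoint x∈⋃C x∈⋃Ĉ)
    forward-unique (Ĉ-pair x∈⋃Ĉ _) (C-pair x∈⋃C _) = ⊥-elim (⋃C-⋃Ĉ-disjoint x∈⋃C x∈⋃Ĉ)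

    γ₁p≢-γ₂p′ : ∀ {p p′} → ⋃C p → ⋃Ĉ p′ → γ₁ * p ≢ - (γ₂ * p′)
    γ₁p≢-γ₂p′ {p} {p′} p∈⋃C p′∈⋃Ĉ γ₁p≡-γ₂p′ = ⋃C-⋃Ĉ-disjoint p∈⋃C (subst ⋃Ĉ (sym p≡p′G) (⋃Ĉ-*g^ i₀ p′∈⋃Ĉ))
      where
      p≡p′G : p ≡ p′ * G
      p≡p′G = trans (*-cancelˡ γ₁≢0 (trans γ₁p≡-γ₂p′ (-γ₂y≡γ₁Gy p′))) (*-comm G p′)

    backward-unique : ∀ {x y z} → Forward y x → Forward z x → y ≡ z
    backward-unique (C-pair _ x≡) (C-pair _ x≡′) = *-cancelˡ γ₁≢0 (trans (sym x≡) x≡′)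
    backward-unique {y = y} {z} (Ĉ-pair _ x≡) (Ĉ-pair _ x≡′) = *-cancelˡ G≢0 (*-cancelˡ γ₁≢0
      (trans (sym (-γ₂y≡γ₁Gy y)) (trans (sym x≡) (trans x≡′ (-γ₂y≡γ₁Gy z)))))
    backward-unique (C-pair y∈⋃C x≡) (Ĉ-pair z∈⋃Ĉ x≡′) = ⊥-elim (γ₁p≢-γ₂p′ y∈⋃C z∈⋃Ĉ (trans (sym x≡) x≡′))
    backward-unique (Ĉ-pair y∈⋃Ĉ x≡) (C-pair z∈⋃C x≡′) = ⊥-elim (γ₁p≢-γ₂p′ z∈⋃C y∈⋃Ĉ (trans (sym x≡′) x≡))

    unique : ∀ {x y z} → PairView x y → PairView x z → y ≡ z
    unique (inj₁ f) (inj₁ f′) = forward-unique f f′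
    unique (inj₂ f) (inj₂ f′) = backward-unique f f′
    unique (inj₁ f) (inj₂ f′) = ⊥-elim (QR≢NQR (proj₁ (forward-QR-NQR f)) (proj₂ (forward-QR-NQR f′)) refl)
    unique (inj₂ f) (inj₁ f′) = ⊥-elim (QR≢NQR (proj₁ (forward-QR-NQR f′)) (proj₂ (forward-QR-NQR f)) refl)

    z/γ₁-QR : ∀ {z} → NQR z → QR (z / γ₁)
    z/γ₁-QR {z} z∈NQR = subst QR (begin
      (z * γ₁) * (γ₁ ⁻¹ * γ₁ ⁻¹)   ≡⟨ solve 3 (λ z a v → (z :* a) :* (v :* v) := (z :* v) :* (a :* v))
                                        refl z γ₁ (γ₁ ⁻¹) ⟩
      (z * γ₁ ⁻¹) * (γ₁ * γ₁ ⁻¹)   ≡⟨ cong ((z / γ₁) *_) (⁻¹-inverse γ₁ γ₁≢0) ⟩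
      (z * γ₁ ⁻¹) * 1#             ≡⟨ *-identityʳ _ ⟩
      z / γ₁                       ∎) (QR-* (NQR*NQR⇒QR z∈NQR γ₁∈NQR) (QR-square (⁻¹-nonzero γ₁≢0)))

    partnerOfQR : ∀ {z} → ⋃C z ⊎ ⋃Ĉ z → ∃ λ y → PairView z y
    partnerOfQR (inj₁ z∈⋃C) = _ , inj₁ (C-pair z∈⋃C refl)
    partnerOfQR (inj₂ z∈⋃Ĉ) = _ , inj₁ (Ĉ-pair z∈⋃Ĉ refl)

    partnerOfNQR : ∀ {z} → ⋃C (z / γ₁) ⊎ ⋃Ĉ (z / γ₁) → ∃ λ y → PairView z y
    partnerOfNQR {z} (inj₁ w∈⋃C) = _ , inj₂ (C-pair w∈⋃C (sym (x*[y/x]≡y z γ₁≢0)))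
    partnerOfNQR {z} (inj₂ w∈⋃Ĉ) = _ , inj₂ (Ĉ-pair (⋃Ĉ-*g^ ((u ℕ.+ u) ℕ.* i₀) w∈⋃Ĉ) (sym (begin
      - (γ₂ * (w * G⁻¹))     ≡⟨ -γ₂y≡γ₁Gy (w * G⁻¹) ⟩
      γ₁ * (G * (w * G⁻¹))   ≡⟨ solve 4 (λ a b w c → a :* (b :* (w :* c)) := (a :* w) :* (b :* c))
                                  refl γ₁ G w G⁻¹ ⟩
      (γ₁ * w) * (G * G⁻¹)   ≡⟨ cong ((γ₁ * w) *_) G*G⁻¹≡1 ⟩
      (γ₁ * w) * 1#          ≡⟨ *-identityʳ _ ⟩
      γ₁ * w                 ≡⟨ x*[y/x]≡y z γ₁≢0 ⟩
      z                      ∎)))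
      where
      w : Carrier
      w = z / γ₁

    covers : ∀ z → z ≢ 0# → ∃ λ y → PairView z y
    covers z z≢0 with QR? z
    ... | yes z∈QR = partnerOfQR (QR⇒⋃C⊎⋃Ĉ z∈QR)
    ... | no  z∉QR = partnerOfNQR (QR⇒⋃C⊎⋃Ĉ (z/γ₁-QR (z≢0 , z∉QR)))

    -- H₂ puts the sums of the two kinds of pairs in different square classes
    [1+γ₁]p≢[1-γ₂]p′ : ∀ {p p′} → ⋃C p → ⋃Ĉ p′ → (1# + γ₁) * p ≢ (1# - γ₂) * p′
    [1+γ₁]p≢[1-γ₂]p′ {p} {p′} p∈⋃C p′∈⋃Ĉ eq = QR≢NQR (QR-square X≢0) X²-NQR refl
      where
      X : Carrier
      X = (1# + γ₁) * p
      X≢0 : X ≢ 0#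
      X≢0 = *-nonzero 1+γ₁≢0 (proj₁ (⋃C⇒QR p∈⋃C))
      [1+γ₁][1-γ₂]-NQR : NQR ((1# + γ₁) * (1# - γ₂))
      [1+γ₁][1-γ₂]-NQR = subst NQR
        (solve 2 (λ a b → :- :1 :* ((a :+ :1) :* (b :- :1)) := (:1 :+ a) :* (:1 :- b)) refl γ₁ γ₂)
        (QR*NQR⇒NQR -1∈QR H₂)
      X²-NQR : NQR (X * X)
      X²-NQR = subst NQR (begin
        (p * p′) * ((1# + γ₁) * (1# - γ₂))   ≡⟨ solve 4 (λ p p′ a b → p :* p′ :* (a :* b) := a :* p :* (b :* p′))
                                                  refl p p′ (1# + γ₁) (1# - γ₂) ⟩
        X * ((1# - γ₂) * p′)                 ≡⟨ cong (X *_) eq ⟨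
        X * X                                ∎)
        (QR*NQR⇒NQR (QR-* (⋃C⇒QR p∈⋃C) (⋃Ĉ⇒QR p′∈⋃Ĉ)) [1+γ₁][1-γ₂]-NQR)

    forward-sum : ∀ {x y} → Forward x y → (⋃C x × x + y ≡ (1# + γ₁) * x) ⊎ (⋃Ĉ x × x + y ≡ (1# - γ₂) * x)
    forward-sum {x} (C-pair x∈⋃C y≡) =
      inj₁ (x∈⋃C , trans (cong (x +_) y≡) (solve 2 (λ x a → x :+ a :* x := (:1 :+ a) :* x) refl x γ₁))
    forward-sum {x} (Ĉ-pair x∈⋃Ĉ y≡) =
      inj₂ (x∈⋃Ĉ , trans (cong (x +_) y≡) (solve 2 (λ x b → x :- b :* x := (:1 :- b) :* x) refl x γ₂))

    forward-sum-injective : ∀ {x y u v} → Forward x y → Forward u v → x + y ≡ u + v → x ≡ u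
    forward-sum-injective f f′ eq with forward-sum f | forward-sum f′
    ... | inj₁ (_ , s) | inj₁ (_ , s′) = *-cancelˡ 1+γ₁≢0 (trans (sym s) (trans eq s′))
    ... | inj₂ (_ , s) | inj₂ (_ , s′) = *-cancelˡ 1-γ₂≢0 (trans (sym s) (trans eq s′))
    ... | inj₁ (x∈⋃C , s) | inj₂ (u∈⋃Ĉ , s′) =
      ⊥-elim ([1+γ₁]p≢[1-γ₂]p′ x∈⋃C u∈⋃Ĉ (trans (sym s) (trans eq s′)))
    ... | inj₂ (x∈⋃Ĉ , s) | inj₁ (u∈⋃C , s′) =
      ⊥-elim ([1+γ₁]p≢[1-γ₂]p′ u∈⋃C x∈⋃Ĉ (trans (sym s′) (trans (sym eq) s)))

    strong : ∀ {x y u v} → PairView x y → PairView u v → x + y ≡ u + v → (u ≡ x × v ≡ y) ⊎ (u ≡ y × v ≡ x)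
    strong (inj₁ f) (inj₁ f′) eq with forward-sum-injective f f′ eq
    ... | refl = inj₁ (refl , forward-unique f′ f)
    strong {u = u} {v} (inj₁ f) (inj₂ f′) eq with forward-sum-injective f f′ (trans eq (+-comm u v))
    ... | refl = inj₂ (forward-unique f′ f , refl)
    strong {x} {y} (inj₂ f) (inj₁ f′) eq with forward-sum-injective f f′ (trans (+-comm y x) eq)
    ... | refl = inj₂ (refl , forward-unique f′ f)
    strong {x} {y} {u} {v} (inj₂ f) (inj₂ f′) eq
      with forward-sum-injective f f′ (trans (+-comm y x) (trans eq (+-comm u v)))
    ... | refl = inj₁ (forward-unique f′ f , refl)

    differenceOfC-pair : ∀ {d} → QR (d / (1# - γ₁)) → ∃[ x ] ∃[ y ] (PairView x y × x - y ≡ d)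
    differenceOfC-pair {d} w∈QR with QR⇒⋃C⊎⋃Ĉ w∈QR
    ... | inj₁ w∈⋃C = w , γ₁ * w , inj₁ (C-pair w∈⋃C refl) ,
      trans (solve 2 (λ w a → w :- a :* w := (:1 :- a) :* w) refl w γ₁) (x*[y/x]≡y d 1-γ₁≢0)
      where w = d / (1# - γ₁)
    ... | inj₂ w∈⋃Ĉ = γ₁ * - w , - w , inj₂ (C-pair (⋃Ĉ⇒-⋃C w∈⋃Ĉ) refl) ,
      trans (solve 2 (λ w a → a :* :- w :- :- w := (:1 :- a) :* w) refl w γ₁) (x*[y/x]≡y d 1-γ₁≢0)
      where w = d / (1# - γ₁)

    differenceOfĈ-pair : ∀ {d} → QR (d / (1# + γ₂)) → ∃[ x ] ∃[ y ] (PairView x y × x - y ≡ d)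
    differenceOfĈ-pair {d} w∈QR with QR⇒⋃C⊎⋃Ĉ w∈QR
    ... | inj₂ w∈⋃Ĉ = w , - (γ₂ * w) , inj₁ (Ĉ-pair w∈⋃Ĉ refl) ,
      trans (solve 2 (λ w b → w :- :- (b :* w) := (:1 :+ b) :* w) refl w γ₂) (x*[y/x]≡y d 1+γ₂≢0)
      where w = d / (1# + γ₂)
    ... | inj₁ w∈⋃C = - (γ₂ * - w) , - w , inj₂ (Ĉ-pair (⋃C⇒-⋃Ĉ w∈⋃C) refl) ,
      trans (solve 2 (λ w b → :- (b :* :- w) :- :- w := (:1 :+ b) :* w) refl w γ₂) (x*[y/x]≡y d 1+γ₂≢0)
      where w = d / (1# + γ₂)

    -- if both quotients were non-squares, H₁ would make the square d² a non-square
    some-quotient-QR : ∀ {d} → d ≢ 0# → QR (d / (1# - γ₁)) ⊎ QR (d / (1# + γ₂))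
    some-quotient-QR {d} d≢0 with QR? (d / (1# - γ₁)) | QR? (d / (1# + γ₂))
    ... | yes w₁∈QR | _         = inj₁ w₁∈QR
    ... | no  _     | yes w₂∈QR = inj₂ w₂∈QR
    ... | no  w₁∉QR | no  w₂∉QR = ⊥-elim (QR≢NQR (QR-square d≢0) w₁w₂e₁e₂-NQR (sym w₁w₂e₁e₂≡d²))
      where
      e₁ e₂ w₁ w₂ : Carrier
      e₁ = 1# - γ₁
      e₂ = 1# + γ₂
      w₁ = d / e₁
      w₂ = d / e₂
      e₁e₂-NQR : NQR (e₁ * e₂)
      e₁e₂-NQR = subst NQR
        (solve 2 (λ a b → :- :1 :* ((a :- :1) :* (b :+ :1)) := (:1 :- a) :* (:1 :+ b)) refl γ₁ γ₂)
        (QR*NQR⇒NQR -1∈QR H₁)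
      w₁w₂e₁e₂-NQR : NQR ((w₁ * w₂) * (e₁ * e₂))
      w₁w₂e₁e₂-NQR = QR*NQR⇒NQR (NQR*NQR⇒QR (*-nonzero d≢0 (⁻¹-nonzero 1-γ₁≢0) , w₁∉QR)
        (*-nonzero d≢0 (⁻¹-nonzero 1+γ₂≢0) , w₂∉QR)) e₁e₂-NQR
      w₁w₂e₁e₂≡d² : (w₁ * w₂) * (e₁ * e₂) ≡ d * d
      w₁w₂e₁e₂≡d² = begin
        (w₁ * w₂) * (e₁ * e₂)   ≡⟨ solve 4 (λ w₁ w₂ e₁ e₂ → w₁ :* w₂ :* (e₁ :* e₂) := e₁ :* w₁ :* (e₂ :* w₂))
                                     refl w₁ w₂ e₁ e₂ ⟩
        (e₁ * w₁) * (e₂ * w₂)   ≡⟨ cong₂ _*_ (x*[y/x]≡y d 1-γ₁≢0) (x*[y/x]≡y d 1+γ₂≢0) ⟩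
        d * d                   ∎

    differences : ∀ d → d ≢ 0# → ∃[ x ] ∃[ y ] (PairView x y × x - y ≡ d)
    differences d d≢0 = [ differenceOfC-pair , differenceOfĈ-pair ]′ (some-quotient-QR d≢0)

    -γ₂≢0 : - γ₂ ≢ 0#
    -γ₂≢0 -γ₂≡0 = proj₁ (-γ₂*QR⇒NQR 1∈QR) (trans (cong -_ (*-identityʳ γ₂)) -γ₂≡0)

    γ₁≢-γ₂ : γ₁ ≢ - γ₂
    γ₁≢-γ₂ γ₁≡-γ₂ = proj₂ H₁ (proj₁ H₁ , ι * (γ₁ - 1#) , (begin
      (ι * (γ₁ - 1#)) * (ι * (γ₁ - 1#))   ≡⟨ [xy]²≡x²y² ι (γ₁ - 1#) ⟩
      (ι * ι) * ((γ₁ - 1#) * (γ₁ - 1#))   ≡⟨ cong (_* ((γ₁ - 1#) * (γ₁ - 1#))) ι²≡-1 ⟩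
      - 1# * ((γ₁ - 1#) * (γ₁ - 1#))      ≡⟨ solve 1 (λ a → :- :1 :* ((a :- :1) :* (a :- :1))
                                                          := (a :- :1) :* (:- a :+ :1)) refl γ₁ ⟩
      (γ₁ - 1#) * (- γ₁ + 1#)             ≡⟨ cong (λ z → (γ₁ - 1#) * (z + 1#)) -γ₁≡γ₂ ⟩
      (γ₁ - 1#) * (γ₂ + 1#)               ∎))
      where
      -γ₁≡γ₂ : - γ₁ ≡ γ₂
      -γ₁≡γ₂ = trans (cong -_ γ₁≡-γ₂) (-‿involutive γ₂)
      ι : Carrier
      ι = proj₁ (proj₂ -1∈QR)
      ι²≡-1 : ι * ι ≡ - 1#
      ι²≡-1 = proj₂ (proj₂ -1∈QR)

    forward-quotient : ∀ {x y} → Forward x y → y / x ≡ γ₁ ⊎ y / x ≡ - γ₂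
    forward-quotient {x} (C-pair x∈⋃C y≡) =
      inj₁ (trans (cong (_/ x) y≡) ([y*x]/x≡y γ₁ (proj₁ (⋃C⇒QR x∈⋃C))))
    forward-quotient {x} (Ĉ-pair x∈⋃Ĉ y≡) =
      inj₂ (trans (cong (_/ x) (trans y≡ (-‿distribˡ-* γ₂ x))) ([y*x]/x≡y (- γ₂) (proj₁ (⋃Ĉ⇒QR x∈⋃Ĉ))))

    isTwoQuotientStrongStarter : IsTwoQuotientStrongStarter (S γ₁ γ₂)
    isTwoQuotientStrongStarter = starter , (λ s₁ s₂ → strong (view s₁) (view s₂)) ,
      (γ₁ , - γ₂ , γ₁≢0 , -γ₂≢0 , γ₁≢-γ₂ , [ inj₁ ∘ forward-quotient , inj₂ ∘ forward-quotient ]′ ∘ view)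
      where
      starter : IsStarter (S γ₁ γ₂)
      starter = record
        { symmetric   = unview ∘ Sum.swap ∘ view
        ; nonzero     = nonzero ∘ view
        ; distinct    = distinct ∘ view
        ; covers      = λ x x≢0 → let y , pv = covers x x≢0 in y , unview pv
        ; unique      = λ s₁ s₂ → unique (view s₁) (view s₂)
        ; differences = λ d d≢0 → let x , y , pv , x-y≡d = differences d d≢0 in x , y , unview pv , x-y≡d
        }

    ⟨1,γ₁⟩∈S : S γ₁ γ₂ 1# γ₁
    ⟨1,γ₁⟩∈S = unview (inj₁ (C-pair 1∈⋃C (sym (*-identityʳ γ₁))))

  -NQR : ∀ {x} → NQR x → NQR (- x)
  -NQR {x} x∈NQR = subst NQR (-1*x≈-x x) (QR*NQR⇒NQR -1∈QR x∈NQR)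

  Ĉ₀-QR : ∀ {c} → Ĉ 0 c → QR c
  Ĉ₀-QR c∈Ĉ₀ with Ĉ₀-exponent c∈Ĉ₀
  ... | i , refl = subst QR (-1*x≈-x (g ^' i))
    (QR-* -1∈QR (subst QR (sym (g^i≡α^[m*i] i)) (α^-QR (m ℕ.* i))))

  Ĉ₀-inverse : ∀ {c} → Ĉ 0 c → ∃[ c′ ] (Ĉ 0 c′ × c * c′ ≡ 1#)
  Ĉ₀-inverse c∈Ĉ₀ with Ĉ₀-exponent c∈Ĉ₀
  ... | i , refl = - g ^' ((u ℕ.+ u) ℕ.* i) , -g^i∈Ĉ₀ ((u ℕ.+ u) ℕ.* i) ,
    trans (-x*-y≡x*y (g ^' i) _) (g^i*g^[2u*i]≡1 i)

  module _ {γ₁ γ₂ : Carrier} (γ₂∈γ₁Ĉ₀ : ∃[ c ] (Ĉ 0 c × γ₂ ≡ γ₁ * c)) where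

    γ₁Ĉ₀-NQR : NQR γ₁ → NQR γ₂
    γ₁Ĉ₀-NQR γ₁∈NQR = let c , c∈Ĉ₀ , γ₂≡γ₁c = γ₂∈γ₁Ĉ₀ in
      subst NQR (trans (*-comm c γ₁) (sym γ₂≡γ₁c)) (QR*NQR⇒NQR (Ĉ₀-QR c∈Ĉ₀) γ₁∈NQR)

    γ₁∈γ₂Ĉ₀ : ∃[ c ] (Ĉ 0 c × γ₁ ≡ γ₂ * c)
    γ₁∈γ₂Ĉ₀ = let c , c∈Ĉ₀ , γ₂≡γ₁c = γ₂∈γ₁Ĉ₀ ; c′ , c′∈Ĉ₀ , cc′≡1 = Ĉ₀-inverse c∈Ĉ₀ in
      c′ , c′∈Ĉ₀ , (begin
        γ₁               ≡⟨ *-identityʳ γ₁ ⟨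
        γ₁ * 1#          ≡⟨ cong (γ₁ *_) cc′≡1 ⟨
        γ₁ * (c * c′)    ≡⟨ *-assoc γ₁ c c′ ⟨
        (γ₁ * c) * c′    ≡⟨ cong (_* c′) γ₂≡γ₁c ⟨
        γ₂ * c′          ∎)

    -γ₂∈-γ₁Ĉ₀ : ∃[ c ] (Ĉ 0 c × - γ₂ ≡ - γ₁ * c)
    -γ₂∈-γ₁Ĉ₀ = let c , c∈Ĉ₀ , γ₂≡γ₁c = γ₂∈γ₁Ĉ₀ in
      c , c∈Ĉ₀ , trans (cong -_ γ₂≡γ₁c) (-‿distribˡ-* γ₁ c)

    γ₂≢γ₁ : NQR γ₁ → γ₂ ≢ γ₁
    γ₂≢γ₁ (γ₁≢0 , _) γ₂≡γ₁ =
      g^i≢-1 i (trans (sym (-‿involutive (g ^' i))) (cong -_ (trans (sym c≡-g^i) c≡1)))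
      where
      c : Carrier
      c = proj₁ γ₂∈γ₁Ĉ₀
      i : ℕ
      i = proj₁ (Ĉ₀-exponent (proj₁ (proj₂ γ₂∈γ₁Ĉ₀)))
      c≡-g^i : c ≡ - g ^' i
      c≡-g^i = proj₂ (Ĉ₀-exponent (proj₁ (proj₂ γ₂∈γ₁Ĉ₀)))
      c≡1 : c ≡ 1#
      c≡1 = *-cancelˡ γ₁≢0 (trans (sym (proj₂ (proj₂ γ₂∈γ₁Ĉ₀))) (trans γ₂≡γ₁ (sym (*-identityʳ γ₁))))

  companionStarters : ∀ β₁ β₂ → NQR β₁ → (∃[ c ] (Ĉ 0 c × β₂ ≡ β₁ * c)) →
    NQR ((β₁ - 1#) * (β₂ + 1#)) → NQR ((β₁ + 1#) * (β₂ - 1#)) →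
    (IsTwoQuotientStrongStarter (S β₂ β₁) × ¬ SamePairSet (S β₂ β₁) (S β₁ β₂))
    × (IsTwoQuotientStrongStarter (S (- β₁) (- β₂)) × ¬ SamePairSet (S (- β₁) (- β₂)) (S β₁ β₂))
    × (IsTwoQuotientStrongStarter (S (- β₂) (- β₁)) × ¬ SamePairSet (S (- β₂) (- β₁)) (S β₁ β₂))
  companionStarters β₁ β₂ β₁∈NQR β₂∈β₁Ĉ₀ H₁ H₂ =
      (S₂₁.isTwoQuotientStrongStarter , differs S₂₁.⟨1,γ₁⟩∈S (γ₂≢γ₁ β₂∈β₁Ĉ₀ β₁∈NQR))
    , (S₋₁₂.isTwoQuotientStrongStarter , differs S₋₁₂.⟨1,γ₁⟩∈S (x≢-x (proj₁ β₁∈NQR) ∘ sym))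
    , (S₋₂₁.isTwoQuotientStrongStarter , differs S₋₂₁.⟨1,γ₁⟩∈S (S₁₂.γ₁≢-γ₂ ∘ sym))
    where
    [a+1][b-1]≡[-a-1][-b+1] : ∀ a b → (a + 1#) * (b - 1#) ≡ (- a - 1#) * (- b + 1#)
    [a+1][b-1]≡[-a-1][-b+1] = solve 2 (λ a b → (a :+ :1) :* (b :- :1) := (:- a :- :1) :* (:- b :+ :1)) refl
    [a-1][b+1]≡[-a+1][-b-1] : ∀ a b → (a - 1#) * (b + 1#) ≡ (- a + 1#) * (- b - 1#)
    [a-1][b+1]≡[-a+1][-b-1] = solve 2 (λ a b → (a :- :1) :* (b :+ :1) := (:- a :+ :1) :* (:- b :- :1)) refl
    H₁′ : NQR ((β₂ + 1#) * (β₁ - 1#))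
    H₁′ = subst NQR (*-comm _ _) H₁
    H₂′ : NQR ((β₂ - 1#) * (β₁ + 1#))
    H₂′ = subst NQR (*-comm _ _) H₂
    β₂∈NQR : NQR β₂
    β₂∈NQR = γ₁Ĉ₀-NQR β₂∈β₁Ĉ₀ β₁∈NQR
    module S₁₂ = Starter β₁ β₂ β₁∈NQR β₂∈β₁Ĉ₀ H₁ H₂
    module S₂₁ = Starter β₂ β₁ β₂∈NQR (γ₁∈γ₂Ĉ₀ β₂∈β₁Ĉ₀) H₂′ H₁′
    module S₋₁₂ = Starter (- β₁) (- β₂) (-NQR β₁∈NQR) (-γ₂∈-γ₁Ĉ₀ β₂∈β₁Ĉ₀)
      (subst NQR ([a+1][b-1]≡[-a-1][-b+1] β₁ β₂) H₂) (subst NQR ([a-1][b+1]≡[-a+1][-b-1] β₁ β₂) H₁)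
    module S₋₂₁ = Starter (- β₂) (- β₁) (-NQR β₂∈NQR) (-γ₂∈-γ₁Ĉ₀ (γ₁∈γ₂Ĉ₀ β₂∈β₁Ĉ₀))
      (subst NQR ([a+1][b-1]≡[-a-1][-b+1] β₂ β₁) H₁′) (subst NQR ([a-1][b+1]≡[-a+1][-b-1] β₂ β₁) H₂′)
    differs : ∀ {γ₁ γ₂} → S γ₁ γ₂ 1# γ₁ → γ₁ ≢ β₁ → ¬ SamePairSet (S γ₁ γ₂) (S β₁ β₂)
    differs {γ₁} ⟨1,γ₁⟩ γ₁≢β₁ same =
      γ₁≢β₁ (S₁₂.unique (S₁₂.view (proj₁ (same 1# γ₁) ⟨1,γ₁⟩)) (S₁₂.view S₁₂.⟨1,γ₁⟩∈S))

%2≡1⇒≡1+[u+u] : ∀ t → t % 2 ≡ 1 → ∃ λ u → t ≡ suc (u ℕ.+ u)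
%2≡1⇒≡1+[u+u] t t%2≡1 = t ℕ./ 2 , ≡.trans (m≡m%n+[m/n]*n t 2)
  (≡.cong₂ ℕ._+_ t%2≡1 (≡.trans (ℕ.*-comm (t ℕ./ 2) 2) (≡.cong (t ℕ./ 2 ℕ.+_) (ℕ.+-identityʳ (t ℕ./ 2)))))

mainTheorem7 : (q k t : ℕ) → IsPrimePower q → q ≡ 2 ℕ.^ k ℕ.* t ℕ.+ 1 → 1 ℕ.< k → 1 ℕ.< t → t % 2 ≡ 1 →
    (F : FiniteField q) → let open FiniteField F in
    (α : Carrier) → GeneratesQR α →
    let open Construction k α in
    (β₁ β₂ : Carrier) → NQR β₁ → (∃[ c ] (Ĉ 0 c × β₂ ≡ β₁ * c)) →
    NQR ((β₁ - 1#) * (β₂ + 1#)) → NQR ((β₁ + 1#) * (β₂ - 1#)) →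
    (IsTwoQuotientStrongStarter (S β₂ β₁) × ¬ SamePairSet (S β₂ β₁) (S β₁ β₂))
    × (IsTwoQuotientStrongStarter (S (- β₁) (- β₂)) × ¬ SamePairSet (S (- β₁) (- β₂)) (S β₁ β₂))
    × (IsTwoQuotientStrongStarter (S (- β₂) (- β₁)) × ¬ SamePairSet (S (- β₂) (- β₁)) (S β₁ β₂))
mainTheorem7 q (suc (suc k₂)) t _ q≡2^k*t+1 (ℕ.s≤s (ℕ.s≤s ℕ.z≤n)) _ t%2≡1 F α α-gen
  with %2≡1⇒≡1+[u+u] t t%2≡1
... | u , ≡.refl = Cosets.companionStarters F α α-gen k₂ u q≡2^k*t+1
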